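{- Suppose $t_1=t_k=0$. Then \[ \sum_{\mu\in L'(\lambda;t_1,\dots,t_k)} q^{|\lambda/\mu|} = \prod_{i=1}^{k-1} q^{n_i t_i + n_{i+1}t_{i+1}+ \frac12 (t_i-t_{i+1})^2} \binom{n_i+n_{i+1}}{n_i+t_i-t_{i+1}}_q . \]
   Context: A Dyck path of length $2n$ is a lattice path from $(0,0)$ to $(n,n)$ with up steps $(0,1)$ and down steps $(1,0)$ never going below $y=x$. For $k\ge0$, $\Delta_k$ denotes the Dyck path of $k$ up steps followed by $k$ down steps, and $\Delta_{n_1,\dots,n_k}$ is the concatenation $\Delta_{n_1}*\cdots*\Delta_{n_k}$ (attaching each path at the end of the previous one). Let $\lambda=\Delta_{n_1,\dots,n_k}$ with $n=n_1+\cdots+n_k$, and let $P_i=(n_1+\cdots+n_{i-1},\,n_1+\cdots+n_i)$ be the peak of the $i$th block $\Delta_{n_i}$. For nonnegative integers $t_1,\dots,t_k$, $L'(\lambda;t_1,\dots,t_k)$ is the set of lattice paths $\mu$ from $(0,0)$ to $(n,n)$ that never go below $\lambda$ and whose intersection with the line of slope $-1$ through $P_i$ is the point $P_i+(-t_i,t_i)$, for each $i\in\{1,\dots,k\}$. $|\lambda/\mu|$ is the area of the region between $\lambda$ and $\mu$. Here $[m]_q=1+q+\cdots+q^{m-1}$, $[m]_q!=[1]_q\cdots[m]_q$, and $\binom{m}{j}_q=\frac{[m]_q!}{[j]_q![m-j]_q!}$ is the $q$-binomial coefficient (zero if $j<0$ or $j>m$). -}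

module Defs where

open import Data.Nat using (ℕ; zero; suc; _+_; _*_; _∸_; _^_; _≤ᵇ_; _≡ᵇ_; _/_; NonZero; ∣_-_∣)
open import Data.Nat.Properties using (m*n≢0)
open import Data.Nat.ListAction using (sum; product)
open import Data.Bool using (Bool; true; false; _∧_; if_then_else_)
open import Data.List using (List; []; _∷_; _++_; replicate; map; take; length; filter; upTo; concat; allFin; foldr)
open import Data.Fin using (Fin; toℕ; inject₁) renaming (suc to fsuc)
open import Relation.Binary.PropositionalEquality using (_≡_)
open import Relation.Nullary.Decidable using (yes; no)
open import Data.Bool.Properties using (T?)

-- Lattice paths: sequences of up steps U = (0,1) and right ("down") steps R = (1,0).

data Step : Set where
  U R : Step

Δ : ℕ → List Step
Δ k = replicate k U ++ replicate k R

Δs : (k : ℕ) → (Fin k → ℕ) → List Step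
Δs k ns = concat (map (λ i → Δ (ns i)) (allFin k))

ups : List Step → ℕ
ups []      = 0
ups (U ∷ p) = suc (ups p)
ups (R ∷ p) = ups p

-- y-coordinate of the lattice point reached after the first j steps of p
-- (its x-coordinate is j ∸ that).  This is the point where p meets the
-- line of slope -1 given by x + y = j.
ycoord : List Step → ℕ → ℕ
ycoord p j = ups (take j p)

words : ℕ → List (List Step)
words zero    = [] ∷ []
words (suc m) = map (U ∷_) (words m) ++ map (R ∷_) (words m)

latticePaths : ℕ → List (List Step)
latticePaths n = filter (λ p → T? (ups p ≡ᵇ n)) (words (n + n))

areaFrom : ℕ → List Step → ℕ
areaFrom h []      = 0
areaFrom h (U ∷ p) = areaFrom (suc h) p
areaFrom h (R ∷ p) = h + areaFrom h p

area : List Step → ℕ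
area = areaFrom 0

-- μ never goes below λ: on every antidiagonal x + y = j the point of μ is
-- weakly above (= weakly to the upper left of) the point of λ.
notBelow : List Step → List Step → Bool
notBelow lam μ = foldr (λ j b → (ycoord lam j ≤ᵇ ycoord μ j) ∧ b) true (upTo (suc (length lam)))

-- |λ/μ| : area between λ and μ (for μ weakly above λ)
skewArea : List Step → List Step → ℕ
skewArea lam μ = area μ ∸ area lam

-- N_i = n_1 + ⋯ + n_i  (with i counted from 0: Npre ns i = sum of the first i blocks)
Npre : {k : ℕ} → (Fin k → ℕ) → ℕ → ℕ
Npre {k} ns i = sum (take i (map ns (allFin k)))

total : {k : ℕ} → (Fin k → ℕ) → ℕ
total {k} ns = Npre ns k

-- P_i = (N_{i-1}, N_i) for block i (here i : Fin k, 0-based).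
peakX peakY : {k : ℕ} → (Fin k → ℕ) → Fin k → ℕ
peakX ns i = Npre ns (toℕ i)
peakY ns i = Npre ns (suc (toℕ i))

-- μ meets the line of slope -1 through P_i exactly at P_i + (-t_i, t_i):
-- the point of μ on x + y = peakX + peakY is (peakX - t_i, peakY + t_i).
meetsAt : {k : ℕ} → (Fin k → ℕ) → (Fin k → ℕ) → List Step → Fin k → Bool
meetsAt ns ts μ i =
  (ycoord μ (peakX ns i + peakY ns i) ≡ᵇ peakY ns i + ts i)
  ∧ (ts i ≤ᵇ peakX ns i)

allFinB : (k : ℕ) → (Fin k → Bool) → Bool
allFinB k f = foldr (λ i b → f i ∧ b) true (allFin k)

L′ : (k : ℕ) → (Fin k → ℕ) → (Fin k → ℕ) → List (List Step)
L′ k ns ts =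
  filter (λ μ → T? (notBelow (Δs k ns) μ ∧ allFinB k (meetsAt ns ts μ)))
         (latticePaths (total ns))

genL′ : ℕ → (k : ℕ) → (Fin k → ℕ) → (Fin k → ℕ) → ℕ
genL′ q k ns ts = sum (map (λ μ → q ^ skewArea (Δs k ns) μ) (L′ k ns ts))

qint : ℕ → ℕ → ℕ
qint q zero    = 0
qint q (suc m) = suc (q * qint q m)

qfact : ℕ → ℕ → ℕ
qfact q zero    = 1
qfact q (suc m) = qint q (suc m) * qfact q m

qfact-nonZero : ∀ q m → NonZero (qfact q m)
qfact-nonZero q zero    = _
qfact-nonZero q (suc m) = m*n≢0 (suc (q * qint q m)) (qfact q m) {{_}} {{qfact-nonZero q m}}

-- binom(m, j)_q = [m]!/([j]![m-j]!) for 0 ≤ j ≤ m (exact division)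
qbinom : ℕ → ℕ → ℕ → ℕ
qbinom q m j with j ≤ᵇ m
... | true  = _/_ (qfact q m) (qfact q j * qfact q (m ∸ j))
                  {{m*n≢0 (qfact q j) (qfact q (m ∸ j)) {{qfact-nonZero q j}} {{qfact-nonZero q (m ∸ j)}}}}
... | false = 0

-- binom(m, a - b)_q with an integer lower index a - b (zero if a - b < 0)
qbinomℤ : ℕ → ℕ → ℕ → ℕ → ℕ
qbinomℤ q m a b = if b ≤ᵇ a then qbinom q m (a ∸ b) else 0

-- Right-hand side, for k = m + 1 blocks (indices 0..m), product over i = 0..m-1
-- of the pair (i, i+1).

linExp : (m : ℕ) → (Fin (suc m) → ℕ) → (Fin (suc m) → ℕ) → ℕ
linExp m ns ts = sum (map (λ i → ns (inject₁ i) * ts (inject₁ i) + ns (fsuc i) * ts (fsuc i)) (allFin m))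

sqSum : (m : ℕ) → (Fin (suc m) → ℕ) → ℕ
sqSum m ts = sum (map (λ i → ∣ ts (inject₁ i) - ts (fsuc i) ∣ * ∣ ts (inject₁ i) - ts (fsuc i) ∣) (allFin m))

-- total q-exponent  Σ_i (n_i t_i + n_{i+1} t_{i+1} + ½ (t_i - t_{i+1})^2)
-- (Σ_i (t_i - t_{i+1})^2 is even when t_1 = t_k, so the division is exact)
rhsExp : (m : ℕ) → (Fin (suc m) → ℕ) → (Fin (suc m) → ℕ) → ℕ
rhsExp m ns ts = linExp m ns ts + sqSum m ts / 2

binomProd : ℕ → (m : ℕ) → (Fin (suc m) → ℕ) → (Fin (suc m) → ℕ) → ℕ
binomProd q m ns ts =
  product (map (λ i → qbinomℤ q (ns (inject₁ i) + ns (fsuc i)) (ns (inject₁ i) + ts (inject₁ i)) (ts (fsuc i))) (allFin m))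

module Submission where

-- Pad the blocks with n_0 = n_{k+1} = 0 and t_0 = t_{k+1} = 0 and cut every path of length 2N
-- along the antidiagonals through the peaks P_0, …, P_{k+1}; segment s (0 ≤ s ≤ k) has length
-- n_s + n_{s+1}, and on it λ is the staircase of n_s right steps followed by n_{s+1} up steps.
--  (1) μ ∈ L'(λ;t) iff μ passes through P_s + (-t_s, t_s) for every s: "never below λ" is
--      automatic, because between two consecutive antidiagonals λ is the lowest path joining
--      the prescribed points.
--  (2) For such μ, |λ/μ| = Σ_s e_s + Σ_s inv(μ_s), where μ_s is the s-th segment, inv counts
--      pairs (up step, later right step), and e_s depends on n_s, t_s, n_{s+1}, t_{s+1} only;
--      with t_0 = t_{k+1} = 0 one has Σ_s e_s = the exponent on the right-hand side.
--  (3) The sum over all words therefore factorises over the segments, and the sum of q^{inv}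
--      over words with a fixed number of up steps is the Gaussian binomial.

open import Defs

open import Data.Bool using (Bool; true; false; _∧_; if_then_else_; T)
open import Data.Bool.Properties using (T?)
open import Data.Empty using (⊥-elim)
open import Data.Fin using (Fin; toℕ; fromℕ; fromℕ<; inject₁) renaming (zero to fzero; suc to fsuc)
open import Data.Fin.Properties using (toℕ-fromℕ; toℕ-fromℕ<; toℕ-inject₁; toℕ<n)
open import Data.List using (List; []; _∷_; _++_; replicate; map; take; drop; length; filter; concat; allFin; tabulate; foldr; applyUpTo)
open import Data.List.Properties using (map-++; map-∘; map-tabulate; ++-assoc; length-++; length-replicate; length-take; length-drop; take-all; take++drop≡id; drop-drop)
open import Data.Nat
open import Data.Nat.DivMod using (m*n/n≡m)
open import Data.Nat.ListAction using (sum; product)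
open import Data.Nat.ListAction.Properties using (sum-++)
open import Data.Nat.Properties
open import Data.Nat.Solver using (module +-*-Solver)
open import Data.Product using (Σ; _,_; _×_; proj₁; proj₂)
open import Data.Sum using (inj₁; inj₂)
open import Function using (_∘_; id)
open import Relation.Binary.PropositionalEquality
open import Relation.Nullary using (yes; no)

open +-*-Solver

true≢false : true ≢ false
true≢false ()

≡ᵇ-true⇒≡ : ∀ {a b} → (a ≡ᵇ b) ≡ true → a ≡ b
≡ᵇ-true⇒≡ {a} {b} e = ≡ᵇ⇒≡ a b (subst T (sym e) _)

≡⇒≡ᵇ-true : ∀ {a b} → a ≡ b → (a ≡ᵇ b) ≡ true
≡⇒≡ᵇ-true {a} {b} e with a ≡ᵇ b | ≡⇒≡ᵇ a b e
... | true | _ = refl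

≢⇒≡ᵇ-false : ∀ {a b} → a ≢ b → (a ≡ᵇ b) ≡ false
≢⇒≡ᵇ-false {a} {b} ne with a ≡ᵇ b in eq
... | false = refl
... | true  = ⊥-elim (ne (≡ᵇ-true⇒≡ eq))

≤ᵇ-true⇒≤ : ∀ {a b} → (a ≤ᵇ b) ≡ true → a ≤ b
≤ᵇ-true⇒≤ {a} {b} e = ≤ᵇ⇒≤ a b (subst T (sym e) _)

≤⇒≤ᵇ-true : ∀ {a b} → a ≤ b → (a ≤ᵇ b) ≡ true
≤⇒≤ᵇ-true {a} {b} p with a ≤ᵇ b | ≤⇒≤ᵇ p
... | true | _ = refl

≤ᵇ-false⇒> : ∀ {a b} → (a ≤ᵇ b) ≡ false → b < a
≤ᵇ-false⇒> {a} {b} e with ≤-<-connex a b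
... | inj₁ p = ⊥-elim (true≢false (trans (sym (≤⇒≤ᵇ-true p)) e))
... | inj₂ p = p

∧-true : ∀ {a b} → a ∧ b ≡ true → (a ≡ true) × (b ≡ true)
∧-true {true} {true} e = refl , refl

≤⇒difference : ∀ {a b} → a ≤ b → Σ ℕ (λ c → b ≡ c + a)
≤⇒difference {a} {b} p = b ∸ a , sym (m∸n+n≡m p)

sumTo : ℕ → (ℕ → ℕ) → ℕ
sumTo zero    f = 0
sumTo (suc r) f = f 0 + sumTo r (f ∘ suc)

prodTo : ℕ → (ℕ → ℕ) → ℕ
prodTo zero    f = 1
prodTo (suc r) f = f 0 * prodTo r (f ∘ suc)

sumTo-cong : ∀ r f g → (∀ s → s < r → f s ≡ g s) → sumTo r f ≡ sumTo r g
sumTo-cong zero    f g e = refl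
sumTo-cong (suc r) f g e = cong₂ _+_ (e 0 z<s) (sumTo-cong r _ _ (λ s p → e (suc s) (s<s p)))

prodTo-cong : ∀ r f g → (∀ s → f s ≡ g s) → prodTo r f ≡ prodTo r g
prodTo-cong zero    f g e = refl
prodTo-cong (suc r) f g e = cong₂ _*_ (e 0) (prodTo-cong r _ _ (e ∘ suc))

sumTo-last : ∀ r f → sumTo (suc r) f ≡ sumTo r f + f r
sumTo-last zero    f = +-identityʳ (f 0)
sumTo-last (suc r) f = trans (cong (f 0 +_) (sumTo-last r (f ∘ suc))) (sym (+-assoc (f 0) _ _))

prodTo-last : ∀ r f → prodTo (suc r) f ≡ prodTo r f * f r
prodTo-last zero    f = trans (*-identityʳ (f 0)) (sym (+-identityʳ (f 0)))
prodTo-last (suc r) f = trans (cong (f 0 *_) (prodTo-last r (f ∘ suc))) (sym (*-assoc (f 0) _ _))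

sumTo-+ : ∀ r f g → sumTo r (λ s → f s + g s) ≡ sumTo r f + sumTo r g
sumTo-+ zero    f g = refl
sumTo-+ (suc r) f g rewrite sumTo-+ r (f ∘ suc) (g ∘ suc) =
  solve 4 (λ a b c d → a :+ b :+ (c :+ d) := a :+ c :+ (b :+ d)) refl (f 0) (g 0) (sumTo r (f ∘ suc)) (sumTo r (g ∘ suc))

sumTo-*ˡ : ∀ r k f → sumTo r (λ s → k * f s) ≡ k * sumTo r f
sumTo-*ˡ zero    k f = sym (*-zeroʳ k)
sumTo-*ˡ (suc r) k f rewrite sumTo-*ˡ r k (f ∘ suc) = sym (*-distribˡ-+ k (f 0) _)

sumTo-zero : ∀ r → sumTo r (λ _ → 0) ≡ 0
sumTo-zero zero    = refl
sumTo-zero (suc r) = sumTo-zero r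

sumTo-mono : ∀ f a b → a ≤ b → sumTo a f ≤ sumTo b f
sumTo-mono f zero    b       p       = z≤n
sumTo-mono f (suc a) (suc b) (s≤s p) = +-monoʳ-≤ (f 0) (sumTo-mono (f ∘ suc) a b p)

sumTo-ends : ∀ m g → sumTo (suc (suc m)) g ≡ g 0 + sumTo m (g ∘ suc) + g (suc m)
sumTo-ends m g = trans (cong (g 0 +_) (sumTo-last m (g ∘ suc))) (sym (+-assoc (g 0) _ _))

allBelow : ℕ → (ℕ → Bool) → Bool
allBelow zero    c = true
allBelow (suc r) c = c 0 ∧ allBelow r (c ∘ suc)

allBelow⇒ : ∀ r c → allBelow r c ≡ true → ∀ s → s < r → c s ≡ true
allBelow⇒ (suc r) c e zero    p with c 0 | e
... | true | _ = refl
allBelow⇒ (suc r) c e (suc s) (s≤s p) with c 0 | e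
... | true | e′ = allBelow⇒ r (c ∘ suc) e′ s p

allBelow⇐ : ∀ r c → (∀ s → s < r → c s ≡ true) → allBelow r c ≡ true
allBelow⇐ zero    c h = refl
allBelow⇐ (suc r) c h rewrite h 0 z<s = allBelow⇐ r (c ∘ suc) (λ s p → h (suc s) (s<s p))

prodTo-if : ∀ q r (c : ℕ → Bool) x →
  prodTo r (λ s → if c s then q ^ x s else 0) ≡ (if allBelow r c then q ^ sumTo r x else 0)
prodTo-if q zero    c x = refl
prodTo-if q (suc r) c x with c 0
... | false = refl
... | true rewrite prodTo-if q r (c ∘ suc) (x ∘ suc) with allBelow r (c ∘ suc)
...   | true  = sym (^-distribˡ-+-* q (x 0) _)
...   | false = *-zeroʳ (q ^ x 0)

wordSum : ℕ → (List Step → ℕ) → ℕ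
wordSum zero    F = F []
wordSum (suc L) F = wordSum L (λ w → F (U ∷ w)) + wordSum L (λ w → F (R ∷ w))

sum-words : ∀ L F → sum (map F (words L)) ≡ wordSum L F
sum-words zero    F = +-identityʳ (F [])
sum-words (suc L) F = begin
  sum (map F (map (U ∷_) (words L) ++ map (R ∷_) (words L)))
    ≡⟨ cong sum (map-++ F (map (U ∷_) (words L)) (map (R ∷_) (words L))) ⟩
  sum (map F (map (U ∷_) (words L)) ++ map F (map (R ∷_) (words L)))
    ≡⟨ sum-++ (map F (map (U ∷_) (words L))) _ ⟩
  sum (map F (map (U ∷_) (words L))) + sum (map F (map (R ∷_) (words L)))
    ≡⟨ cong₂ _+_ (trans (cong sum (sym (map-∘ (words L)))) (sum-words L _))
                 (trans (cong sum (sym (map-∘ (words L)))) (sum-words L _)) ⟩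
  wordSum (suc L) F ∎
  where open ≡-Reasoning

sum-filter : ∀ {A : Set} (b : A → Bool) (g : A → ℕ) xs →
  sum (map g (filter (λ x → T? (b x)) xs)) ≡ sum (map (λ x → if b x then g x else 0) xs)
sum-filter b g []       = refl
sum-filter b g (x ∷ xs) with b x
... | true  = cong (g x +_) (sum-filter b g xs)
... | false = sum-filter b g xs

wordSum-cong : ∀ L F G → (∀ w → length w ≡ L → F w ≡ G w) → wordSum L F ≡ wordSum L G
wordSum-cong zero    F G h = h [] refl
wordSum-cong (suc L) F G h = cong₂ _+_ (wordSum-cong L _ _ (λ w e → h (U ∷ w) (cong suc e)))
                                       (wordSum-cong L _ _ (λ w e → h (R ∷ w) (cong suc e)))

wordSum-*ˡ : ∀ L k F → wordSum L (λ w → k * F w) ≡ k * wordSum L F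
wordSum-*ˡ zero    k F = refl
wordSum-*ˡ (suc L) k F =
  trans (cong₂ _+_ (wordSum-*ˡ L k (λ w → F (U ∷ w))) (wordSum-*ˡ L k (λ w → F (R ∷ w)))) (sym (*-distribˡ-+ k _ _))

wordSum-*ʳ : ∀ L k F → wordSum L (λ w → F w * k) ≡ wordSum L F * k
wordSum-*ʳ zero    k F = refl
wordSum-*ʳ (suc L) k F =
  trans (cong₂ _+_ (wordSum-*ʳ L k (λ w → F (U ∷ w))) (wordSum-*ʳ L k (λ w → F (R ∷ w))))
        (sym (*-distribʳ-+ k (wordSum L (λ w → F (U ∷ w))) _))

wordSum-zero : ∀ L → wordSum L (λ _ → 0) ≡ 0
wordSum-zero zero    = refl
wordSum-zero (suc L) = cong₂ _+_ (wordSum-zero L) (wordSum-zero L)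

wordSum-++ : ∀ a b F → wordSum (a + b) F ≡ wordSum a (λ u → wordSum b (λ v → F (u ++ v)))
wordSum-++ zero    b F = refl
wordSum-++ (suc a) b F = cong₂ _+_ (wordSum-++ a b _) (wordSum-++ a b _)

rights : List Step → ℕ
rights []      = 0
rights (U ∷ w) = rights w
rights (R ∷ w) = suc (rights w)

inversions : List Step → ℕ
inversions []      = 0
inversions (U ∷ w) = rights w + inversions w
inversions (R ∷ w) = inversions w

length≡rights+ups : ∀ w → length w ≡ rights w + ups w
length≡rights+ups []      = refl
length≡rights+ups (U ∷ w) = trans (cong suc (length≡rights+ups w)) (sym (+-suc (rights w) (ups w)))
length≡rights+ups (R ∷ w) = cong suc (length≡rights+ups w)

-- The Gaussian binomial [ℓ choose c]_q through the q-Pascal recursion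
-- [ℓ+1, c+1] = q^{ℓ-c} [ℓ, c] + [ℓ, c+1] (splitting on a leading up step).
gauss : ℕ → ℕ → ℕ → ℕ
gauss q zero    zero    = 1
gauss q zero    (suc c) = 0
gauss q (suc ℓ) zero    = gauss q ℓ zero
gauss q (suc ℓ) (suc c) = q ^ (ℓ ∸ c) * gauss q ℓ c + gauss q ℓ (suc c)

upsWeight : ℕ → ℕ → List Step → ℕ
upsWeight q c w = if ups w ≡ᵇ c then q ^ inversions w else 0

wordSum-upsWeight : ∀ q ℓ c → wordSum ℓ (upsWeight q c) ≡ gauss q ℓ c
wordSum-upsWeight q zero    zero    = refl
wordSum-upsWeight q zero    (suc c) = refl
wordSum-upsWeight q (suc ℓ) zero    =
  trans (cong (_+ wordSum ℓ (upsWeight q zero)) (wordSum-zero ℓ)) (wordSum-upsWeight q ℓ zero)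
wordSum-upsWeight q (suc ℓ) (suc c) = cong₂ _+_ leadingUp (wordSum-upsWeight q ℓ (suc c))
  where
    -- a leading up step precedes the ℓ - c right steps of the rest
    weightAfterUp : ∀ w → length w ≡ ℓ → upsWeight q (suc c) (U ∷ w) ≡ q ^ (ℓ ∸ c) * upsWeight q c w
    weightAfterUp w e with ups w ≡ᵇ c in eq
    ... | false = sym (*-zeroʳ (q ^ (ℓ ∸ c)))
    ... | true  = trans (cong (λ z → q ^ (z + inversions w)) rights≡) (^-distribˡ-+-* q (ℓ ∸ c) (inversions w))
      where
        rights≡ : rights w ≡ ℓ ∸ c
        rights≡ = begin
          rights w                  ≡⟨ sym (m+n∸n≡m (rights w) (ups w)) ⟩
          rights w + ups w ∸ ups w  ≡⟨ cong₂ _∸_ (trans (sym (length≡rights+ups w)) e) (≡ᵇ-true⇒≡ {ups w} {c} eq) ⟩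
          ℓ ∸ c                     ∎
          where open ≡-Reasoning
    leadingUp : wordSum ℓ (λ w → upsWeight q (suc c) (U ∷ w)) ≡ q ^ (ℓ ∸ c) * gauss q ℓ c
    leadingUp = trans (wordSum-cong ℓ _ _ weightAfterUp)
                      (trans (wordSum-*ˡ ℓ (q ^ (ℓ ∸ c)) (upsWeight q c)) (cong (q ^ (ℓ ∸ c) *_) (wordSum-upsWeight q ℓ c)))

gauss-zero : ∀ q ℓ → gauss q ℓ 0 ≡ 1
gauss-zero q zero    = refl
gauss-zero q (suc ℓ) = gauss-zero q ℓ

gauss-above : ∀ q ℓ c → ℓ < c → gauss q ℓ c ≡ 0
gauss-above q zero    (suc c) p       = refl
gauss-above q (suc ℓ) (suc c) (s≤s p) =
  cong₂ _+_ (trans (cong (q ^ (ℓ ∸ c) *_) (gauss-above q ℓ c p)) (*-zeroʳ (q ^ (ℓ ∸ c))))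
            (gauss-above q ℓ (suc c) (m<n⇒m<1+n p))

gauss-diag : ∀ q ℓ → gauss q ℓ ℓ ≡ 1
gauss-diag q zero    = refl
gauss-diag q (suc ℓ) = begin
  q ^ (ℓ ∸ ℓ) * gauss q ℓ ℓ + gauss q ℓ (suc ℓ)
    ≡⟨ cong₂ (λ a b → q ^ a * gauss q ℓ ℓ + b) (n∸n≡0 ℓ) (gauss-above q ℓ (suc ℓ) ≤-refl) ⟩
  1 * gauss q ℓ ℓ + 0  ≡⟨ trans (+-identityʳ _) (*-identityˡ _) ⟩
  gauss q ℓ ℓ          ≡⟨ gauss-diag q ℓ ⟩
  1                    ∎
  where open ≡-Reasoning

qint-+ : ∀ q a b → qint q (a + b) ≡ qint q a + q ^ a * qint q b
qint-+ q zero    b = sym (+-identityʳ (qint q b))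
qint-+ q (suc a) b = trans (cong (λ z → suc (q * z)) (qint-+ q a b))
  (solve 4 (λ q A P B → con 1 :+ q :* (A :+ P :* B) := con 1 :+ q :* A :+ q :* P :* B) refl q (qint q a) (q ^ a) (qint q b))

gauss-factorials : ∀ q c r → gauss q (c + r) c * (qfact q c * qfact q r) ≡ qfact q (c + r)
gauss-factorials q zero    r = trans (cong (_* (1 * qfact q r)) (gauss-zero q r)) (trans (*-identityˡ _) (*-identityˡ _))
gauss-factorials q (suc c) zero rewrite +-identityʳ c =
  trans (cong (_* (qfact q (suc c) * 1)) (gauss-diag q (suc c))) (trans (*-identityˡ _) (*-identityʳ _))
gauss-factorials q (suc c) (suc r) = begin
  (q ^ ((c + suc r) ∸ c) * G₁ + G₂) * ((A * fc) * (B * fr))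
    ≡⟨ cong (λ z → (q ^ z * G₁ + G₂) * ((A * fc) * (B * fr))) (m+n∸m≡n c (suc r)) ⟩
  (P * G₁ + G₂) * ((A * fc) * (B * fr))
    ≡⟨ solve 7 (λ P G₁ G₂ A B fc fr → (P :* G₁ :+ G₂) :* ((A :* fc) :* (B :* fr))
                 := (P :* A) :* (G₁ :* (fc :* (B :* fr))) :+ B :* (G₂ :* ((A :* fc) :* fr))) refl P G₁ G₂ A B fc fr ⟩
  (P * A) * (G₁ * (fc * (B * fr))) + B * (G₂ * ((A * fc) * fr))
    ≡⟨ cong₂ (λ x y → (P * A) * x + B * y) (gauss-factorials q c (suc r)) secondTerm ⟩
  (P * A) * Q + B * Q  ≡⟨ solve 4 (λ P A B Q → P :* A :* Q :+ B :* Q := (B :+ P :* A) :* Q) refl P A B Q ⟩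
  (B + P * A) * Q      ≡⟨ cong (_* Q) (sym (qint-+ q (suc r) (suc c))) ⟩
  qint q (suc r + suc c) * Q  ≡⟨ cong (λ z → qint q z * Q) (+-comm (suc r) (suc c)) ⟩
  qfact q (suc (c + suc r)) ∎
  where
    open ≡-Reasoning
    G₁ = gauss q (c + suc r) c
    G₂ = gauss q (c + suc r) (suc c)
    A = qint q (suc c)
    B = qint q (suc r)
    fc = qfact q c
    fr = qfact q r
    P = q ^ suc r
    Q = qfact q (c + suc r)
    secondTerm : G₂ * ((A * fc) * fr) ≡ Q
    secondTerm = subst (λ z → gauss q z (suc c) * ((A * fc) * fr) ≡ qfact q z) (sym (+-suc c r)) (gauss-factorials q (suc c) r)

/-exact : ∀ a b g .{{_ : NonZero b}} → a ≡ g * b → a / b ≡ g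
/-exact a b g e = trans (cong (_/ b) e) (m*n/n≡m g b)

qbinom≡gauss : ∀ q c r → qbinom q (c + r) r ≡ gauss q (c + r) c
qbinom≡gauss q c r with r ≤ᵇ c + r in eq
... | false = ⊥-elim (<⇒≱ (≤ᵇ-false⇒> eq) (m≤n+m r c))
... | true  = /-exact _ _ _ {{m*n≢0 (qfact q r) (qfact q (c + r ∸ r)) {{qfact-nonZero q r}} {{qfact-nonZero q (c + r ∸ r)}}}} (sym (begin
    gauss q (c + r) c * (qfact q r * qfact q (c + r ∸ r))
      ≡⟨ cong (λ z → gauss q (c + r) c * (qfact q r * qfact q z)) (m+n∸n≡m c r) ⟩
    gauss q (c + r) c * (qfact q r * qfact q c)
      ≡⟨ cong (gauss q (c + r) c *_) (*-comm (qfact q r) (qfact q c)) ⟩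
    gauss q (c + r) c * (qfact q c * qfact q r)
      ≡⟨ gauss-factorials q c r ⟩
    qfact q (c + r) ∎))
  where open ≡-Reasoning

qbinom-above : ∀ q m j → m < j → qbinom q m j ≡ 0
qbinom-above q m j p with j ≤ᵇ m in eq
... | false = refl
... | true  = ⊥-elim (<⇒≱ p (≤ᵇ-true⇒≤ eq))

-- Segment weight: words of a segment entered at offset t whose exit offset is fixed, i.e.
-- whose number of up steps raised by t equals c′; each is weighted by q^{inv}.
shiftedWeight : ℕ → ℕ → ℕ → List Step → ℕ
shiftedWeight q t c′ w = if ups w + t ≡ᵇ c′ then q ^ inversions w else 0

≡ᵇ-+-cancelʳ : ∀ a b t → (a + t ≡ᵇ b + t) ≡ (a ≡ᵇ b)
≡ᵇ-+-cancelʳ a b t with a ≡ᵇ b in e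
... | true rewrite ≡ᵇ-true⇒≡ {a} {b} e = ≡⇒≡ᵇ-true {b + t} refl
... | false = ≢⇒≡ᵇ-false (λ e′ → true≢false (trans (sym (≡⇒≡ᵇ-true {a} {b} (+-cancelʳ-≡ t a b e′))) e))

-- If the exit offset is below the entry offset no word qualifies, and the binomial
-- [n+n′ choose n+t-t′]_q vanishes as well (its lower index exceeds n + n′ or is negative).
qbinomℤ-vanishes : ∀ q n t n′ t′ → n′ + t′ < t → qbinomℤ q (n + n′) (n + t) t′ ≡ 0
qbinomℤ-vanishes q n t n′ t′ p with t′ ≤ᵇ n + t in eq
... | false = refl
... | true with ≤⇒difference (≤ᵇ-true⇒≤ {t′} eq)
... | j , ej rewrite ej | m+n∸n≡m j t′ = qbinom-above q (n + n′) j (+-cancelʳ-< t′ (n + n′) j (begin-strict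
  n + n′ + t′    ≡⟨ +-assoc n n′ t′ ⟩
  n + (n′ + t′)  <⟨ +-monoʳ-< n p ⟩
  n + t          ≡⟨ ej ⟩
  j + t′         ∎))
  where open ≤-Reasoning

-- Otherwise the qualifying words are those with c = n′ + t′ - t up steps, and the binomial
-- [n+n′ choose n+t-t′]_q is the Gaussian [n+n′ choose c]_q (both vanish if c > n + n′).
qbinomℤ≡gauss : ∀ q n t n′ t′ c → n′ + t′ ≡ c + t → qbinomℤ q (n + n′) (n + t) t′ ≡ gauss q (n + n′) c
qbinomℤ≡gauss q n t n′ t′ c ec with t′ ≤ᵇ n + t in eq
... | false = sym (gauss-above q (n + n′) c (+-cancelʳ-< t (n + n′) c (begin-strict
  n + n′ + t    ≡⟨ solve 3 (λ n n′ t → n :+ n′ :+ t := n′ :+ (n :+ t)) refl n n′ t ⟩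
  n′ + (n + t)  <⟨ +-monoʳ-< n′ (≤ᵇ-false⇒> eq) ⟩
  n′ + t′       ≡⟨ ec ⟩
  c + t         ∎)))
  where open ≤-Reasoning
... | true with ≤⇒difference (≤ᵇ-true⇒≤ {t′} eq)
... | j , ej rewrite ej | m+n∸n≡m j t′ =
  trans (cong (λ z → qbinom q z j) lengths) (trans (qbinom≡gauss q c j) (cong (λ z → gauss q z c) (sym lengths)))
  where
    lengths : n + n′ ≡ c + j
    lengths = +-cancelʳ-≡ (t + t′) (n + n′) (c + j) (begin
      n + n′ + (t + t′)    ≡⟨ solve 4 (λ n n′ t t′ → n :+ n′ :+ (t :+ t′) := (n :+ t) :+ (n′ :+ t′)) refl n n′ t t′ ⟩
      (n + t) + (n′ + t′)  ≡⟨ cong₂ _+_ ej ec ⟩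
      (j + t′) + (c + t)   ≡⟨ solve 4 (λ j t′ c t → (j :+ t′) :+ (c :+ t) := c :+ j :+ (t :+ t′)) refl j t′ c t ⟩
      c + j + (t + t′)     ∎)
      where open ≡-Reasoning

wordSum-shiftedWeight : ∀ q n t n′ t′ →
  wordSum (n + n′) (shiftedWeight q t (n′ + t′)) ≡ qbinomℤ q (n + n′) (n + t) t′
wordSum-shiftedWeight q n t n′ t′ with t ≤? n′ + t′
... | no t≰ = trans (wordSum-cong _ _ _ noWord) (trans (wordSum-zero (n + n′)) (sym (qbinomℤ-vanishes q n t n′ t′ (≰⇒> t≰))))
  where
    noWord : ∀ w → length w ≡ n + n′ → shiftedWeight q t (n′ + t′) w ≡ 0
    noWord w _ rewrite ≢⇒≡ᵇ-false {ups w + t} {n′ + t′} (λ e → t≰ (subst (t ≤_) e (m≤n+m t (ups w)))) = refl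
... | yes t≤ with ≤⇒difference t≤
... | c , ec = trans (wordSum-cong _ _ _ exactlyC) (trans (wordSum-upsWeight q (n + n′) c) (sym (qbinomℤ≡gauss q n t n′ t′ c ec)))
  where
    exactlyC : ∀ w → length w ≡ n + n′ → shiftedWeight q t (n′ + t′) w ≡ upsWeight q c w
    exactlyC w _ rewrite ec | ≡ᵇ-+-cancelʳ (ups w) c t = refl

segment : (ℕ → ℕ) → ℕ → List Step → List Step
segment ℓ s μ = take (ℓ s) (drop (sumTo s ℓ) μ)

take-length-++ : ∀ (u v : List Step) → take (length u) (u ++ v) ≡ u
take-length-++ []      v = refl
take-length-++ (x ∷ u) v = cong (x ∷_) (take-length-++ u v)

drop-length-++ : ∀ (u v : List Step) k → drop (length u + k) (u ++ v) ≡ drop k v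
drop-length-++ []      v k = refl
drop-length-++ (x ∷ u) v k = drop-length-++ u v k

wordSum-segments : ∀ r ℓ (f : ℕ → List Step → ℕ) →
  wordSum (sumTo r ℓ) (λ μ → prodTo r (λ s → f s (segment ℓ s μ))) ≡ prodTo r (λ s → wordSum (ℓ s) (f s))
wordSum-segments zero    ℓ f = refl
wordSum-segments (suc r) ℓ f = begin
  wordSum (ℓ 0 + sumTo r (ℓ ∘ suc)) (λ μ → prodTo (suc r) (λ s → f s (segment ℓ s μ)))
    ≡⟨ wordSum-++ (ℓ 0) (sumTo r (ℓ ∘ suc)) _ ⟩
  wordSum (ℓ 0) (λ u → wordSum (sumTo r (ℓ ∘ suc)) (λ v → prodTo (suc r) (λ s → f s (segment ℓ s (u ++ v)))))
    ≡⟨ wordSum-cong (ℓ 0) _ _ firstSegment ⟩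
  wordSum (ℓ 0) (λ u → f 0 u * prodTo r (λ s → wordSum (ℓ (suc s)) (f (suc s))))
    ≡⟨ wordSum-*ʳ (ℓ 0) _ (f 0) ⟩
  prodTo (suc r) (λ s → wordSum (ℓ s) (f s)) ∎
  where
    open ≡-Reasoning
    firstSegment : ∀ u → length u ≡ ℓ 0 →
      wordSum (sumTo r (ℓ ∘ suc)) (λ v → prodTo (suc r) (λ s → f s (segment ℓ s (u ++ v))))
        ≡ f 0 u * prodTo r (λ s → wordSum (ℓ (suc s)) (f (suc s)))
    firstSegment u e = begin
      wordSum (sumTo r (ℓ ∘ suc)) (λ v → prodTo (suc r) (λ s → f s (segment ℓ s (u ++ v))))
        ≡⟨ wordSum-cong (sumTo r (ℓ ∘ suc)) _ _ (λ v _ → cong₂ _*_ (cong (f 0) (head≡ v)) (prodTo-cong r _ _ (λ s → cong (f (suc s)) (tail≡ s v)))) ⟩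
      wordSum (sumTo r (ℓ ∘ suc)) (λ v → f 0 u * prodTo r (λ s → f (suc s) (segment (ℓ ∘ suc) s v)))
        ≡⟨ wordSum-*ˡ (sumTo r (ℓ ∘ suc)) (f 0 u) _ ⟩
      f 0 u * wordSum (sumTo r (ℓ ∘ suc)) (λ v → prodTo r (λ s → f (suc s) (segment (ℓ ∘ suc) s v)))
        ≡⟨ cong (f 0 u *_) (wordSum-segments r (ℓ ∘ suc) (f ∘ suc)) ⟩
      f 0 u * prodTo r (λ s → wordSum (ℓ (suc s)) (f (suc s))) ∎
      where
        head≡ : ∀ v → take (ℓ 0) (u ++ v) ≡ u
        head≡ v = trans (cong (λ z → take z (u ++ v)) (sym e)) (take-length-++ u v)
        tail≡ : ∀ s v → segment ℓ (suc s) (u ++ v) ≡ segment (ℓ ∘ suc) s v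
        tail≡ s v = cong (take (ℓ (suc s))) (trans (cong (λ z → drop (z + sumTo s (ℓ ∘ suc)) (u ++ v)) (sym e)) (drop-length-++ u v _))

-- It differs from the area under w only by a term depending on ups w
-- (heightSum-area), and unlike the area it is additive along w with an explicit shift.
heightSum : ℕ → List Step → ℕ
heightSum h []      = 0
heightSum h (U ∷ w) = suc h + heightSum (suc h) w
heightSum h (R ∷ w) = h + heightSum h w

ups-++ : ∀ u v → ups (u ++ v) ≡ ups u + ups v
ups-++ []      v = refl
ups-++ (U ∷ u) v = cong suc (ups-++ u v)
ups-++ (R ∷ u) v = ups-++ u v

heightSum-++ : ∀ h u v → heightSum h (u ++ v) ≡ heightSum h u + heightSum (h + ups u) v
heightSum-++ h []      v = cong (λ z → heightSum z v) (sym (+-identityʳ h))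
heightSum-++ h (U ∷ u) v = trans (cong (suc h +_) (heightSum-++ (suc h) u v))
  (trans (sym (+-assoc (suc h) _ _)) (cong (λ z → suc h + heightSum (suc h) u + heightSum z v) (sym (+-suc h (ups u)))))
heightSum-++ h (R ∷ u) v = trans (cong (h +_) (heightSum-++ h u v)) (sym (+-assoc h _ _))

heightSum-shift : ∀ h w → heightSum h w ≡ h * length w + heightSum 0 w
heightSum-shift h [] = sym (trans (+-identityʳ _) (*-zeroʳ h))
heightSum-shift h (U ∷ w) rewrite heightSum-shift (suc h) w | heightSum-shift 1 w =
  solve 3 (λ h L Y → con 1 :+ h :+ ((con 1 :+ h) :* L :+ Y) := h :* (con 1 :+ L) :+ (con 1 :+ (con 1 :* L :+ Y))) refl h (length w) (heightSum 0 w)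
heightSum-shift h (R ∷ w) rewrite heightSum-shift h w =
  solve 3 (λ h L Y → h :+ (h :* L :+ Y) := h :* (con 1 :+ L) :+ Y) refl h (length w) (heightSum 0 w)

tri : ℕ → ℕ
tri zero    = 0
tri (suc u) = suc u + tri u

heightSum-inversions : ∀ w → heightSum 0 w ≡ inversions w + tri (ups w)
heightSum-inversions [] = refl
heightSum-inversions (U ∷ w) rewrite heightSum-shift 1 w | heightSum-inversions w | length≡rights+ups w =
  solve 4 (λ a b c d → con 1 :+ (con 1 :* (a :+ b) :+ (c :+ d)) := a :+ c :+ (con 1 :+ b :+ d)) refl (rights w) (ups w) (inversions w) (tri (ups w))
heightSum-inversions (R ∷ w) = heightSum-inversions w

triFrom : ℕ → ℕ → ℕ
triFrom h zero    = 0
triFrom h (suc u) = suc h + triFrom (suc h) u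

heightSum-area : ∀ h p → heightSum h p ≡ areaFrom h p + triFrom h (ups p)
heightSum-area h [] = refl
heightSum-area h (U ∷ p) rewrite heightSum-area (suc h) p =
  solve 3 (λ a b c → a :+ (b :+ c) := b :+ (a :+ c)) refl (suc h) (areaFrom (suc h) p) (triFrom (suc h) (ups p))
heightSum-area h (R ∷ p) rewrite heightSum-area h p = sym (+-assoc h _ _)

ycoord-+ : ∀ a b (μ : List Step) → ycoord μ (a + b) ≡ ycoord μ a + ycoord (drop a μ) b
ycoord-+ zero    b μ       = refl
ycoord-+ (suc a) zero    []      = refl
ycoord-+ (suc a) (suc b) []      = refl
ycoord-+ (suc a) b       (U ∷ μ) = cong suc (ycoord-+ a b μ)
ycoord-+ (suc a) b       (R ∷ μ) = ycoord-+ a b μ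

heightSum-segments : ∀ r ℓ h μ → length μ ≡ sumTo r ℓ →
  heightSum h μ ≡ sumTo r (λ s → heightSum (h + ycoord μ (sumTo s ℓ)) (segment ℓ s μ))
heightSum-segments zero    ℓ h [] e = refl
heightSum-segments (suc r) ℓ h μ e = begin
  heightSum h μ                                     ≡⟨ cong (heightSum h) (sym (take++drop≡id (ℓ 0) μ)) ⟩
  heightSum h (take (ℓ 0) μ ++ drop (ℓ 0) μ)          ≡⟨ heightSum-++ h (take (ℓ 0) μ) (drop (ℓ 0) μ) ⟩
  heightSum h (take (ℓ 0) μ) + heightSum (h + ycoord μ (ℓ 0)) (drop (ℓ 0) μ)
    ≡⟨ cong₂ _+_ (cong (λ z → heightSum z (take (ℓ 0) μ)) (sym (+-identityʳ h)))
                 (heightSum-segments r (ℓ ∘ suc) _ (drop (ℓ 0) μ) restLength) ⟩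
  heightSum (h + 0) (take (ℓ 0) μ)
    + sumTo r (λ s → heightSum (h + ycoord μ (ℓ 0) + ycoord (drop (ℓ 0) μ) (sumTo s (ℓ ∘ suc))) (segment (ℓ ∘ suc) s (drop (ℓ 0) μ)))
    ≡⟨ cong (heightSum (h + 0) (take (ℓ 0) μ) +_) (sumTo-cong r _ _ (λ s _ → cong₂ heightSum (entryHeight s) (restSegment s))) ⟩
  sumTo (suc r) (λ s → heightSum (h + ycoord μ (sumTo s ℓ)) (segment ℓ s μ)) ∎
  where
    open ≡-Reasoning
    restLength : length (drop (ℓ 0) μ) ≡ sumTo r (ℓ ∘ suc)
    restLength = trans (length-drop (ℓ 0) μ) (trans (cong (_∸ ℓ 0) e) (m+n∸m≡n (ℓ 0) _))
    entryHeight : ∀ s → h + ycoord μ (ℓ 0) + ycoord (drop (ℓ 0) μ) (sumTo s (ℓ ∘ suc)) ≡ h + ycoord μ (ℓ 0 + sumTo s (ℓ ∘ suc))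
    entryHeight s = trans (+-assoc h _ _) (cong (h +_) (sym (ycoord-+ (ℓ 0) _ μ)))
    restSegment : ∀ s → segment (ℓ ∘ suc) s (drop (ℓ 0) μ) ≡ segment ℓ (suc s) μ
    restSegment s = cong (take (ℓ (suc s))) (drop-drop (ℓ 0) _ μ)

-- On a segment with n right and n′ up steps of λ, entered at
-- offset t and left at offset t′ (offsets measured along the antidiagonals), the path μ lies
-- above λ by  excess n t n′ t′ + inversions  (segment-excess).  Explicitly
-- 2·excess + t = 2nt + 2n′t′ + (t - t′)² + t′ (twice-excess), which telescopes to the
-- exponent of the theorem.
excess : ℕ → ℕ → ℕ → ℕ → ℕ
excess n t n′ t′ = n * t + n′ * t′ + (if t′ ≤ᵇ t then tri ((t ∸ t′) ∸ 1) else tri (t′ ∸ t))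

tri-+ : ∀ a b → tri (a + b) ≡ tri a + tri b + a * b
tri-+ zero    b = sym (+-identityʳ (tri b))
tri-+ (suc a) b rewrite tri-+ a b =
  solve 4 (λ a b A B → con 1 :+ (a :+ b) :+ (A :+ B :+ a :* b) := con 1 :+ a :+ A :+ B :+ (b :+ a :* b)) refl a b (tri a) (tri b)

tri-suc+tri : ∀ d → tri (suc d) + tri d ≡ suc d * suc d
tri-suc+tri zero    = refl
tri-suc+tri (suc d) = begin
  (suc (suc d) + (suc d + tri d)) + (suc d + tri d)
    ≡⟨ solve 2 (λ d T → (con 2 :+ d :+ (con 1 :+ d :+ T)) :+ (con 1 :+ d :+ T) := con 2 :+ d :+ (con 1 :+ d) :+ (con 1 :+ d :+ T :+ T)) refl d (tri d) ⟩
  suc (suc d) + suc d + (suc d + tri d + tri d)  ≡⟨ cong (suc (suc d) + suc d +_) (tri-suc+tri d) ⟩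
  suc (suc d) + suc d + suc d * suc d            ≡⟨ solve 1 (λ d → con 2 :+ d :+ (con 1 :+ d) :+ (con 1 :+ d) :* (con 1 :+ d) := (con 2 :+ d) :* (con 2 :+ d)) refl d ⟩
  suc (suc d) * suc (suc d)                      ∎
  where open ≡-Reasoning

2*tri : ∀ x → 2 * tri x ≡ x * suc x
2*tri zero    = refl
2*tri (suc x) = begin
  2 * (suc x + tri x)        ≡⟨ *-distribˡ-+ 2 (suc x) (tri x) ⟩
  2 * suc x + 2 * tri x      ≡⟨ cong (2 * suc x +_) (2*tri x) ⟩
  2 * suc x + x * suc x      ≡⟨ solve 1 (λ x → con 2 :* (con 1 :+ x) :+ x :* (con 1 :+ x) := (con 1 :+ x) :* (con 2 :+ x)) refl x ⟩
  suc x * suc (suc x)        ∎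
  where open ≡-Reasoning

segment-excess-descending : ∀ n u d t′ →
  (n + (u + d)) * (d + t′) + tri u ≡ tri (u + d) + (n * (d + t′) + (u + d) * t′ + tri (d ∸ 1))
segment-excess-descending n u zero t′ rewrite +-identityʳ u =
  solve 4 (λ n u t′ T → (n :+ u) :* t′ :+ T := T :+ (n :* t′ :+ u :* t′ :+ con 0)) refl n u t′ (tri u)
segment-excess-descending n u (suc d) t′ rewrite tri-+ u (suc d) = begin
  (n + (u + suc d)) * (suc d + t′) + tri u
    ≡⟨ solve 5 (λ n u d t′ Tu → (n :+ (u :+ (con 1 :+ d))) :* ((con 1 :+ d) :+ t′) :+ Tu
                 := Tu :+ u :* (con 1 :+ d) :+ (n :* ((con 1 :+ d) :+ t′) :+ (u :+ (con 1 :+ d)) :* t′) :+ (con 1 :+ d) :* (con 1 :+ d)) refl n u d t′ (tri u) ⟩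
  tri u + u * suc d + (n * (suc d + t′) + (u + suc d) * t′) + suc d * suc d
    ≡⟨ cong (tri u + u * suc d + (n * (suc d + t′) + (u + suc d) * t′) +_) (sym (tri-suc+tri d)) ⟩
  tri u + u * suc d + (n * (suc d + t′) + (u + suc d) * t′) + (tri (suc d) + tri d)
    ≡⟨ solve 6 (λ A B C D X Y → A :+ B :+ (C :+ D) :+ (X :+ Y) := A :+ X :+ B :+ (C :+ D :+ Y)) refl (tri u) (u * suc d) (n * (suc d + t′)) ((u + suc d) * t′) (tri (suc d)) (tri d) ⟩
  tri u + tri (suc d) + u * suc d + (n * (suc d + t′) + (u + suc d) * t′ + tri d) ∎
  where open ≡-Reasoning

segment-excess-ascending : ∀ n t n′ e →
  (n + n′) * t + tri (n′ + suc e) ≡ tri n′ + (n * t + n′ * (suc e + t) + tri (suc e + t ∸ t))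
segment-excess-ascending n t n′ e = begin
  (n + n′) * t + tri (n′ + suc e)  ≡⟨ cong ((n + n′) * t +_) (tri-+ n′ (suc e)) ⟩
  (n + n′) * t + (tri n′ + tri (suc e) + n′ * suc e)
    ≡⟨ solve 6 (λ n n′ t e A B → (n :+ n′) :* t :+ (A :+ B :+ n′ :* (con 1 :+ e)) := A :+ (n :* t :+ n′ :* ((con 1 :+ e) :+ t) :+ B)) refl n n′ t e (tri n′) (tri (suc e)) ⟩
  tri n′ + (n * t + n′ * (suc e + t) + tri (suc e))
    ≡⟨ cong (λ z → tri n′ + (n * t + n′ * (suc e + t) + tri z)) (sym (m+n∸n≡m (suc e) t)) ⟩
  tri n′ + (n * t + n′ * (suc e + t) + tri (suc e + t ∸ t)) ∎
  where open ≡-Reasoning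

segment-excess : ∀ n t n′ t′ u → u + t ≡ n′ + t′ → (n + n′) * t + tri u ≡ tri n′ + excess n t n′ t′
segment-excess n t n′ t′ u e with t′ ≤ᵇ t in eq
... | true with ≤⇒difference (≤ᵇ-true⇒≤ {t′} eq)
... | d , ed with n′≡u+d
  where
    n′≡u+d : n′ ≡ u + d
    n′≡u+d = +-cancelʳ-≡ t′ n′ (u + d) (trans (sym e) (trans (cong (u +_) ed) (sym (+-assoc u d t′))))
... | refl rewrite ed | m+n∸n≡m d t′ = segment-excess-descending n u d t′
segment-excess n t n′ t′ u e | false with ≤⇒difference (≤ᵇ-false⇒> {t′} eq)
... | e′ , ee with u≡n′+1+e′
  where
    u≡n′+1+e′ : u ≡ n′ + suc e′
    u≡n′+1+e′ = +-cancelʳ-≡ t u (n′ + suc e′) (trans e (trans (cong (n′ +_) (trans ee (+-suc e′ t)))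
      (solve 3 (λ n′ e t → n′ :+ ((con 1 :+ e) :+ t) := n′ :+ (con 1 :+ e) :+ t) refl n′ e′ t)))
... | refl rewrite trans ee (+-suc e′ t) = segment-excess-ascending n t n′ e′

∣d+t-t∣≡d : ∀ d t → ∣ d + t - t ∣ ≡ d
∣d+t-t∣≡d d t = trans (∣-∣-comm (d + t) t) (trans (cong (λ z → ∣ t - z ∣) (+-comm d t)) (∣m-m+n∣≡n t d))

twice-excess : ∀ n t n′ t′ → 2 * excess n t n′ t′ + t ≡ 2 * (n * t) + 2 * (n′ * t′) + ∣ t - t′ ∣ * ∣ t - t′ ∣ + t′
twice-excess n t n′ t′ with t′ ≤ᵇ t in eq
... | true with ≤⇒difference (≤ᵇ-true⇒≤ {t′} eq)
... | zero , ed rewrite ed | n∸n≡0 t′ | ∣d+t-t∣≡d zero t′ =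
  solve 3 (λ n n′ t′ → con 2 :* (n :* t′ :+ n′ :* t′ :+ con 0) :+ t′ := con 2 :* (n :* t′) :+ con 2 :* (n′ :* t′) :+ con 0 :+ t′) refl n n′ t′
... | suc d , ed rewrite ed | m+n∸n≡m (suc d) t′ | ∣d+t-t∣≡d (suc d) t′ = begin
  2 * (A + B + tri d) + (suc d + t′)     ≡⟨ solve 5 (λ A B T d t′ → con 2 :* (A :+ B :+ T) :+ ((con 1 :+ d) :+ t′) := con 2 :* A :+ con 2 :* B :+ con 2 :* T :+ (con 1 :+ d) :+ t′) refl A B (tri d) d t′ ⟩
  2 * A + 2 * B + 2 * tri d + suc d + t′ ≡⟨ cong (λ z → 2 * A + 2 * B + z + suc d + t′) (2*tri d) ⟩
  2 * A + 2 * B + d * suc d + suc d + t′ ≡⟨ solve 4 (λ A B d t′ → con 2 :* A :+ con 2 :* B :+ d :* (con 1 :+ d) :+ (con 1 :+ d) :+ t′ := con 2 :* A :+ con 2 :* B :+ (con 1 :+ d) :* (con 1 :+ d) :+ t′) refl A B d t′ ⟩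
  2 * A + 2 * B + suc d * suc d + t′     ∎
  where
    open ≡-Reasoning
    A = n * (suc d + t′)
    B = n′ * t′
twice-excess n t n′ t′ | false with ≤⇒difference (≤ᵇ-false⇒> {t′} eq)
... | e , ee rewrite trans ee (+-suc e t) | m+n∸n≡m (suc e) t | ∣-∣-comm t (suc e + t) | ∣d+t-t∣≡d (suc e) t = begin
  2 * (A + B + tri (suc e)) + t            ≡⟨ solve 4 (λ A B T t → con 2 :* (A :+ B :+ T) :+ t := con 2 :* A :+ con 2 :* B :+ con 2 :* T :+ t) refl A B (tri (suc e)) t ⟩
  2 * A + 2 * B + 2 * tri (suc e) + t      ≡⟨ cong (λ z → 2 * A + 2 * B + z + t) (2*tri (suc e)) ⟩
  2 * A + 2 * B + suc e * suc (suc e) + t  ≡⟨ solve 4 (λ A B e t → con 2 :* A :+ con 2 :* B :+ (con 1 :+ e) :* (con 2 :+ e) :+ t := con 2 :* A :+ con 2 :* B :+ (con 1 :+ e) :* (con 1 :+ e) :+ ((con 1 :+ e) :+ t)) refl A B e t ⟩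
  2 * A + 2 * B + suc e * suc e + (suc e + t) ∎
  where
    open ≡-Reasoning
    A = n * t
    B = n′ * (suc e + t)

-- Block data are functions on Fin (suc m); extend turns them into ℕ-indexed sequences that
-- vanish beyond index m, so that block sums become ordinary sums over ranges.
extend : (m : ℕ) → (Fin (suc m) → ℕ) → ℕ → ℕ
extend m f zero          = f fzero
extend zero    f (suc j) = 0
extend (suc m) f (suc j) = extend m (f ∘ fsuc) j

extend-toℕ : ∀ m f (i : Fin (suc m)) → f i ≡ extend m f (toℕ i)
extend-toℕ m       f fzero    = refl
extend-toℕ (suc m) f (fsuc i) = extend-toℕ m (f ∘ fsuc) i

extend-beyond : ∀ m f j → m < j → extend m f j ≡ 0
extend-beyond zero    f (suc j) p       = refl
extend-beyond (suc m) f (suc j) (s≤s p) = extend-beyond m (f ∘ fsuc) j p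

sum-allFin : ∀ n (G : Fin n → ℕ) g → (∀ i → G i ≡ g (toℕ i)) → sum (map G (allFin n)) ≡ sumTo n g
sum-allFin n G g h = trans (cong sum (map-tabulate id G)) (sum-tabulate n G g h)
  where
    sum-tabulate : ∀ n (G : Fin n → ℕ) g → (∀ i → G i ≡ g (toℕ i)) → sum (tabulate G) ≡ sumTo n g
    sum-tabulate zero    G g h = refl
    sum-tabulate (suc n) G g h = cong₂ _+_ (h fzero) (sum-tabulate n (G ∘ fsuc) (g ∘ suc) (h ∘ fsuc))

product-allFin : ∀ n (G : Fin n → ℕ) g → (∀ i → G i ≡ g (toℕ i)) → product (map G (allFin n)) ≡ prodTo n g
product-allFin n G g h = trans (cong product (map-tabulate id G)) (product-tabulate n G g h)
  where
    product-tabulate : ∀ n (G : Fin n → ℕ) g → (∀ i → G i ≡ g (toℕ i)) → product (tabulate G) ≡ prodTo n g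
    product-tabulate zero    G g h = refl
    product-tabulate (suc n) G g h = cong₂ _*_ (h fzero) (product-tabulate n (G ∘ fsuc) (g ∘ suc) (h ∘ fsuc))

Npre≡sumTo : ∀ m (ns : Fin (suc m) → ℕ) i → Npre ns i ≡ sumTo i (extend m ns)
Npre≡sumTo m ns i = trans (cong (λ z → sum (take i z)) (map-tabulate id ns)) (prefix m ns i)
  where
    prefix : ∀ m f i → sum (take i (tabulate {n = suc m} f)) ≡ sumTo i (extend m f)
    prefix m       f zero          = refl
    prefix zero    f (suc zero)    = refl
    prefix zero    f (suc (suc i)) = cong (f fzero +_) (sym (sumTo-zero i))
    prefix (suc m) f (suc i)       = cong (f fzero +_) (prefix m (f ∘ fsuc) i)

allFinB⇒ : ∀ k f → allFinB k f ≡ true → ∀ i → f i ≡ true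
allFinB⇒ k f = conj⇒ k id
  where
    conj⇒ : ∀ n (g : Fin n → Fin k) → foldr (λ i b → f i ∧ b) true (tabulate g) ≡ true → ∀ i → f (g i) ≡ true
    conj⇒ (suc n) g e i with f (g fzero) in eq | e
    conj⇒ (suc n) g e fzero    | true | _  = eq
    conj⇒ (suc n) g e (fsuc i) | true | e′ = conj⇒ n (g ∘ fsuc) e′ i

allFinB⇐ : ∀ k f → (∀ i → f i ≡ true) → allFinB k f ≡ true
allFinB⇐ k f = conj⇐ k id
  where
    conj⇐ : ∀ n (g : Fin n → Fin k) → (∀ i → f (g i) ≡ true) → foldr (λ i b → f i ∧ b) true (tabulate g) ≡ true
    conj⇐ zero    g h = refl
    conj⇐ (suc n) g h rewrite h fzero = conj⇐ n (g ∘ fsuc) (h ∘ fsuc)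

upTo⇐ : ∀ n (g : ℕ → ℕ) (P : ℕ → Bool) →
  (∀ j → j < n → P (g j) ≡ true) → foldr (λ j b → P j ∧ b) true (applyUpTo g n) ≡ true
upTo⇐ zero    g P h = refl
upTo⇐ (suc n) g P h rewrite h 0 z<s = upTo⇐ n (g ∘ suc) P (λ j p → h (suc j) (s<s p))

-- The staircase of a sequence f: segment s consists of f s right steps followed by f (s+1)
-- up steps.  With f = (0, n_1, …, n_k, 0) it is λ = Δ_{n_1,…,n_k} (Δs≡staircase).
staircase : ℕ → (ℕ → ℕ) → List Step
staircase zero    f = []
staircase (suc r) f = replicate (f 0) R ++ (replicate (f 1) U ++ staircase r (f ∘ suc))

staircase-cong : ∀ r f g → (∀ j → f j ≡ g j) → staircase r f ≡ staircase r g
staircase-cong zero    f g h = refl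
staircase-cong (suc r) f g h rewrite h 0 | h 1 =
  cong (λ z → replicate (g 0) R ++ (replicate (g 1) U ++ z)) (staircase-cong r (f ∘ suc) (g ∘ suc) (h ∘ suc))

prepend : ℕ → (ℕ → ℕ) → ℕ → ℕ
prepend a h zero    = a
prepend a h (suc j) = h j

Δs-cons : ∀ k (ns : Fin (suc k) → ℕ) → Δs (suc k) ns ≡ Δ (ns fzero) ++ Δs k (ns ∘ fsuc)
Δs-cons k ns = cong (λ z → Δ (ns fzero) ++ concat z)
  (trans (map-tabulate fsuc (λ i → Δ (ns i))) (sym (map-tabulate id (λ i → Δ (ns (fsuc i))))))

Δs≡staircase : ∀ m ns a → replicate a R ++ Δs (suc m) ns ≡ staircase (suc (suc m)) (prepend a (extend m ns))
Δs≡staircase zero    ns a = cong (replicate a R ++_) (++-assoc (replicate (ns fzero) U) (replicate (ns fzero) R) [])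
Δs≡staircase (suc m) ns a = begin
  replicate a R ++ Δs (suc (suc m)) ns  ≡⟨ cong (replicate a R ++_) (Δs-cons (suc m) ns) ⟩
  replicate a R ++ ((replicate n₀ U ++ replicate n₀ R) ++ Δs (suc m) (ns ∘ fsuc))
    ≡⟨ cong (replicate a R ++_) (++-assoc (replicate n₀ U) (replicate n₀ R) _) ⟩
  replicate a R ++ (replicate n₀ U ++ (replicate n₀ R ++ Δs (suc m) (ns ∘ fsuc)))
    ≡⟨ cong (λ z → replicate a R ++ (replicate n₀ U ++ z)) (Δs≡staircase m (ns ∘ fsuc) n₀) ⟩
  replicate a R ++ (replicate n₀ U ++ staircase (suc (suc m)) (prepend n₀ (extend m (ns ∘ fsuc))))
    ≡⟨ cong (λ z → replicate a R ++ (replicate n₀ U ++ z)) (staircase-cong (suc (suc m)) _ _ shifted) ⟩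
  staircase (suc (suc (suc m))) (prepend a (extend (suc m) ns)) ∎
  where
    open ≡-Reasoning
    n₀ = ns fzero
    shifted : ∀ j → prepend n₀ (extend m (ns ∘ fsuc)) j ≡ prepend a (extend (suc m) ns) (suc j)
    shifted zero    = refl
    shifted (suc j) = refl

ups-replicateU : ∀ b → ups (replicate b U) ≡ b
ups-replicateU zero    = refl
ups-replicateU (suc b) = cong suc (ups-replicateU b)

ups-replicateR : ∀ a → ups (replicate a R) ≡ 0
ups-replicateR zero    = refl
ups-replicateR (suc a) = ups-replicateR a

ups-staircase : ∀ r f → ups (staircase r f) ≡ sumTo r (f ∘ suc)
ups-staircase zero    f = refl
ups-staircase (suc r) f rewrite ups-++ (replicate (f 0) R) (replicate (f 1) U ++ staircase r (f ∘ suc))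
  | ups-++ (replicate (f 1) U) (staircase r (f ∘ suc)) | ups-replicateR (f 0) | ups-replicateU (f 1) | ups-staircase r (f ∘ suc) = refl

length-staircase : ∀ r f → length (staircase r f) ≡ sumTo r (λ s → f s + f (suc s))
length-staircase zero    f = refl
length-staircase (suc r) f rewrite length-++ (replicate (f 0) R) {replicate (f 1) U ++ staircase r (f ∘ suc)}
  | length-++ (replicate (f 1) U) {staircase r (f ∘ suc)} | length-replicate (f 0) {R} | length-replicate (f 1) {U} | length-staircase r (f ∘ suc) =
  sym (+-assoc (f 0) (f 1) _)

heightSum-replicateR : ∀ h a → heightSum h (replicate a R) ≡ a * h
heightSum-replicateR h zero    = refl
heightSum-replicateR h (suc a) = cong (h +_) (heightSum-replicateR h a)

heightSum-replicateU : ∀ h b → heightSum h (replicate b U) ≡ b * h + tri b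
heightSum-replicateU h zero    = refl
heightSum-replicateU h (suc b) rewrite heightSum-replicateU (suc h) b =
  solve 3 (λ h b T → con 1 :+ h :+ (b :* (con 1 :+ h) :+ T) := h :+ b :* h :+ (con 1 :+ b :+ T)) refl h b (tri b)

heightSum-staircase : ∀ r f h → heightSum h (staircase r f)
  ≡ sumTo r (λ s → (f s + f (suc s)) * (h + sumTo s (f ∘ suc)) + tri (f (suc s)))
heightSum-staircase zero    f h = refl
heightSum-staircase (suc r) f h = begin
  heightSum h (replicate a R ++ (replicate b U ++ rest))
    ≡⟨ heightSum-++ h (replicate a R) _ ⟩
  heightSum h (replicate a R) + heightSum (h + ups (replicate a R)) (replicate b U ++ rest)
    ≡⟨ cong₂ (λ x y → x + heightSum (h + y) (replicate b U ++ rest)) (heightSum-replicateR h a) (ups-replicateR a) ⟩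
  a * h + heightSum (h + 0) (replicate b U ++ rest)
    ≡⟨ cong (a * h +_) (heightSum-++ (h + 0) (replicate b U) rest) ⟩
  a * h + (heightSum (h + 0) (replicate b U) + heightSum (h + 0 + ups (replicate b U)) rest)
    ≡⟨ cong₂ (λ x y → a * h + (x + heightSum (h + 0 + y) rest)) (heightSum-replicateU (h + 0) b) (ups-replicateU b) ⟩
  a * h + ((b * (h + 0) + tri b) + heightSum (h + 0 + b) rest)
    ≡⟨ cong (λ z → a * h + ((b * (h + 0) + tri b) + z)) restSum ⟩
  a * h + ((b * (h + 0) + tri b) + X)
    ≡⟨ solve 5 (λ a b h T X → a :* h :+ ((b :* (h :+ con 0) :+ T) :+ X) := (a :+ b) :* (h :+ con 0) :+ T :+ X) refl a b h (tri b) X ⟩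
  (a + b) * (h + 0) + tri b + X ∎
  where
    open ≡-Reasoning
    a = f 0
    b = f 1
    rest = staircase r (f ∘ suc)
    X = sumTo r (λ s → (f (suc s) + f (suc (suc s))) * (h + (b + sumTo s (f ∘ suc ∘ suc))) + tri (f (suc (suc s))))
    restSum : heightSum (h + 0 + b) rest ≡ X
    restSum = trans (cong (λ z → heightSum (z + b) rest) (+-identityʳ h))
      (trans (heightSum-staircase r (f ∘ suc) (h + b))
             (sumTo-cong r _ _ (λ s _ → cong (λ z → (f (suc s) + f (suc (suc s))) * z + tri (f (suc (suc s)))) (+-assoc h b _))))

ycoord-≤ : ∀ (w : List Step) j → ycoord w j ≤ j
ycoord-≤ w       zero    = z≤n
ycoord-≤ []      (suc j) = z≤n
ycoord-≤ (U ∷ w) (suc j) = s≤s (ycoord-≤ w j)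
ycoord-≤ (R ∷ w) (suc j) = m≤n⇒m≤1+n (ycoord-≤ w j)

ycoord-mono : ∀ w a d → ycoord w a ≤ ycoord w (a + d)
ycoord-mono w a d rewrite ycoord-+ a d w = m≤m+n _ _

ycoord-lipschitz : ∀ w a d → ycoord w (a + d) ≤ ycoord w a + d
ycoord-lipschitz w a d rewrite ycoord-+ a d w = +-monoʳ-≤ (ycoord w a) (ycoord-≤ (drop a w) d)

ycoord-afterRights : ∀ a i w → ycoord (replicate a R ++ w) i ≤ i ∸ a
ycoord-afterRights zero    i       w = ycoord-≤ w i
ycoord-afterRights (suc a) zero    w = z≤n
ycoord-afterRights (suc a) (suc i) w = ycoord-afterRights a i w

ycoord-staircase : ∀ r f s i → s < r → i ≤ f s + f (suc s) →
  ycoord (staircase r f) (sumTo s (λ j → f j + f (suc j)) + i) ≤ sumTo s (f ∘ suc) + (i ∸ f s)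
ycoord-staircase (suc r) f zero    i p       q = ycoord-afterRights (f 0) i _
ycoord-staircase (suc r) f (suc s) i (s≤s p) q = begin
  ycoord L ((f 0 + f 1 + P′) + i)    ≡⟨ cong (ycoord L) (+-assoc (f 0 + f 1) P′ i) ⟩
  ycoord L ((f 0 + f 1) + (P′ + i))  ≡⟨ ycoord-+ (f 0 + f 1) (P′ + i) L ⟩
  ycoord L (f 0 + f 1) + ycoord (drop (f 0 + f 1) L) (P′ + i)
    ≡⟨ cong₂ _+_ firstHeight (cong (λ z → ycoord z (P′ + i)) firstDropped) ⟩
  f 1 + ycoord rest (P′ + i)         ≤⟨ +-monoʳ-≤ (f 1) (ycoord-staircase r (f ∘ suc) s i p q) ⟩
  f 1 + (sumTo s (f ∘ suc ∘ suc) + (i ∸ f (suc s)))  ≡⟨ sym (+-assoc (f 1) _ _) ⟩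
  sumTo (suc s) (f ∘ suc) + (i ∸ f (suc s)) ∎
  where
    open ≤-Reasoning
    L = staircase (suc r) f
    P′ = sumTo s (λ j → f (suc j) + f (suc (suc j)))
    A = replicate (f 0) R
    B = replicate (f 1) U
    rest = staircase r (f ∘ suc)
    lengthAB : length (A ++ B) ≡ f 0 + f 1
    lengthAB = trans (length-++ A) (cong₂ _+_ (length-replicate (f 0)) (length-replicate (f 1)))
    firstHeight : ycoord L (f 0 + f 1) ≡ f 1
    firstHeight = begin-equality
      ups (take (f 0 + f 1) (A ++ (B ++ rest)))          ≡⟨ cong (λ z → ups (take (f 0 + f 1) z)) (sym (++-assoc A B rest)) ⟩
      ups (take (f 0 + f 1) ((A ++ B) ++ rest))          ≡⟨ cong (λ z → ups (take z ((A ++ B) ++ rest))) (sym lengthAB) ⟩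
      ups (take (length (A ++ B)) ((A ++ B) ++ rest))    ≡⟨ cong ups (take-length-++ (A ++ B) rest) ⟩
      ups (A ++ B)                                       ≡⟨ ups-++ A B ⟩
      ups A + ups B                                      ≡⟨ cong₂ _+_ (ups-replicateR (f 0)) (ups-replicateU (f 1)) ⟩
      f 1 ∎
    firstDropped : drop (f 0 + f 1) L ≡ rest
    firstDropped = trans (cong (drop (f 0 + f 1)) (sym (++-assoc A B rest)))
      (trans (cong (λ z → drop z ((A ++ B) ++ rest)) (trans (sym lengthAB) (sym (+-identityʳ _))))
             (drop-length-++ (A ++ B) rest 0))

segment-cover : ∀ r ℓ j → 0 < r → j ≤ sumTo r ℓ → Σ ℕ λ s → Σ ℕ λ i → s < r × i ≤ ℓ s × j ≡ sumTo s ℓ + i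
segment-cover (suc r) ℓ j _ p with j ≤? ℓ 0
... | yes q = 0 , j , z<s , q , refl
segment-cover (suc zero) ℓ j _ p | no q = ⊥-elim (q (subst (j ≤_) (+-identityʳ (ℓ 0)) p))
segment-cover (suc (suc r)) ℓ j _ p | no q with segment-cover (suc r) (ℓ ∘ suc) (j ∸ ℓ 0) z<s inRest
  where
    inRest : j ∸ ℓ 0 ≤ sumTo (suc r) (ℓ ∘ suc)
    inRest = +-cancelˡ-≤ (ℓ 0) _ _ (subst (_≤ ℓ 0 + sumTo (suc r) (ℓ ∘ suc)) (sym (m+[n∸m]≡n (<⇒≤ (≰⇒> q)))) p)
... | s , i , s< , i≤ , e =
  suc s , i , s<s s< , i≤ , trans (sym (m+[n∸m]≡n (<⇒≤ (≰⇒> q)))) (trans (cong (ℓ 0 +_) e) (sym (+-assoc (ℓ 0) _ i)))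

-- The block data of the theorem: k = m + 1 blocks, padded by n_0 = n_{k+1} = 0 and
-- t_0 = t_{k+1} = 0.  The r = k + 1 segments lie between the antidiagonals through the padded
-- peaks; segment s has length ℓ s = n_s + n_{s+1} and starts at position diag s; the peak
-- P_s has height Nsum (suc s) = n_0 + ⋯ + n_s.
module Blocks (m : ℕ) (ns ts : Fin (suc m) → ℕ) where

  r : ℕ
  r = suc (suc m)

  n̂ t̂ : ℕ → ℕ
  n̂ = prepend 0 (extend m ns)
  t̂ = prepend 0 (extend m ts)

  ℓ : ℕ → ℕ
  ℓ s = n̂ s + n̂ (suc s)

  diag Nsum : ℕ → ℕ
  diag s = sumTo s ℓ
  Nsum s = sumTo s n̂

  N : ℕ
  N = total ns

  lam : List Step
  lam = Δs (suc m) ns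

  n̂-last : n̂ r ≡ 0
  n̂-last = extend-beyond m ns (suc m) ≤-refl

  t̂-last : t̂ r ≡ 0
  t̂-last = extend-beyond m ts (suc m) ≤-refl

  diag≡ : ∀ s → diag s ≡ Nsum s + Nsum (suc s)
  diag≡ s = sumTo-+ s n̂ (n̂ ∘ suc)

  Nsum-last : ∀ s → Nsum (suc s) ≡ Nsum s + n̂ s
  Nsum-last s = sumTo-last s n̂

  diag-last : ∀ s → diag (suc s) ≡ diag s + ℓ s
  diag-last s = sumTo-last s ℓ

  Nsum-end : Nsum (suc r) ≡ N
  Nsum-end = trans (Nsum-last r) (trans (cong₂ _+_ (sym (Npre≡sumTo m ns (suc m))) n̂-last) (+-identityʳ N))

  lam≡staircase : lam ≡ staircase r n̂
  lam≡staircase = Δs≡staircase m ns 0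

  length-lam : length lam ≡ diag r
  length-lam = trans (cong length lam≡staircase) (length-staircase r n̂)

  ups-lam : ups lam ≡ N
  ups-lam = trans (cong ups lam≡staircase) (trans (ups-staircase r n̂) Nsum-end)

  N+N≡diag : N + N ≡ diag r
  N+N≡diag = sym (trans (diag≡ r) (cong₂ _+_ (sym (Npre≡sumTo m ns (suc m))) Nsum-end))

  -- μ meets the antidiagonal through the padded peak P_s at P_s + (-t_s, t_s)
  passes : List Step → ℕ → Set
  passes μ s = ycoord μ (diag s) ≡ Nsum (suc s) + t̂ s

  passesAll : List Step → Set
  passesAll μ = ∀ s → s ≤ r → passes μ s

  -- segment s of μ rises from offset t_s to offset t_{s+1}
  segmentFits : List Step → ℕ → Bool
  segmentFits μ s = ups (segment ℓ s μ) + t̂ s ≡ᵇ n̂ (suc s) + t̂ (suc s)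

  ycoord-next : ∀ μ s → ycoord μ (diag (suc s)) ≡ ycoord μ (diag s) + ups (segment ℓ s μ)
  ycoord-next μ s = trans (cong (ycoord μ) (diag-last s)) (ycoord-+ (diag s) (ℓ s) μ)

  passes-next : ∀ μ s → passes μ s → segmentFits μ s ≡ true → passes μ (suc s)
  passes-next μ s p fits = begin
    ycoord μ (diag (suc s))        ≡⟨ ycoord-next μ s ⟩
    ycoord μ (diag s) + u          ≡⟨ cong (_+ u) p ⟩
    Nsum (suc s) + t̂ s + u        ≡⟨ solve 3 (λ a b c → a :+ b :+ c := a :+ (c :+ b)) refl (Nsum (suc s)) (t̂ s) u ⟩
    Nsum (suc s) + (u + t̂ s)      ≡⟨ cong (Nsum (suc s) +_) (≡ᵇ-true⇒≡ {u + t̂ s} fits) ⟩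
    Nsum (suc s) + (n̂ (suc s) + t̂ (suc s))  ≡⟨ sym (+-assoc (Nsum (suc s)) _ _) ⟩
    Nsum (suc s) + n̂ (suc s) + t̂ (suc s)    ≡⟨ cong (_+ t̂ (suc s)) (sym (Nsum-last (suc s))) ⟩
    Nsum (suc (suc s)) + t̂ (suc s) ∎
    where
      open ≡-Reasoning
      u = ups (segment ℓ s μ)

  passes⇒fits : ∀ μ s → passes μ s → passes μ (suc s) → segmentFits μ s ≡ true
  passes⇒fits μ s p p′ = ≡⇒≡ᵇ-true {u + t̂ s} (+-cancelˡ-≡ (Nsum (suc s)) _ _ (begin
    Nsum (suc s) + (u + t̂ s)      ≡⟨ solve 3 (λ a b c → a :+ (c :+ b) := a :+ b :+ c) refl (Nsum (suc s)) (t̂ s) u ⟩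
    Nsum (suc s) + t̂ s + u        ≡⟨ cong (_+ u) (sym p) ⟩
    ycoord μ (diag s) + u          ≡⟨ sym (ycoord-next μ s) ⟩
    ycoord μ (diag (suc s))        ≡⟨ p′ ⟩
    Nsum (suc (suc s)) + t̂ (suc s)           ≡⟨ cong (_+ t̂ (suc s)) (Nsum-last (suc s)) ⟩
    Nsum (suc s) + n̂ (suc s) + t̂ (suc s)    ≡⟨ +-assoc (Nsum (suc s)) _ _ ⟩
    Nsum (suc s) + (n̂ (suc s) + t̂ (suc s))  ∎))
    where
      open ≡-Reasoning
      u = ups (segment ℓ s μ)

  fits⇒passesAll : ∀ μ → (∀ s → s < r → segmentFits μ s ≡ true) → passesAll μ
  fits⇒passesAll μ h zero    p = refl
  fits⇒passesAll μ h (suc s) p = passes-next μ s (fits⇒passesAll μ h s (≤-trans (n≤1+n s) p)) (h s p)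

  passesAll⇒fits : ∀ μ → passesAll μ → ∀ s → s < r → segmentFits μ s ≡ true
  passesAll⇒fits μ h s p = passes⇒fits μ s (h s (<⇒≤ p)) (h (suc s) p)

  isPath inL′ : List Step → Bool
  isPath μ = ups μ ≡ᵇ N
  inL′ μ = notBelow lam μ ∧ allFinB (suc m) (meetsAt ns ts μ)

  ycoord-end : ∀ μ → length μ ≡ diag r → ycoord μ (diag r) ≡ ups μ
  ycoord-end μ e = cong ups (take-all (diag r) μ (≤-reflexive e))

  lastPoint : Nsum (suc r) + t̂ r ≡ N
  lastPoint = trans (cong₂ _+_ Nsum-end t̂-last) (+-identityʳ N)

  -- meetsAt for block i is passage at the padded peak i + 1 (plus t_i ≤ x-coordinate of P_i)
  meetsAt≡ : ∀ μ (i : Fin (suc m)) → meetsAt ns ts μ i ≡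
    ((ycoord μ (diag (suc (toℕ i))) ≡ᵇ Nsum (suc (suc (toℕ i))) + t̂ (suc (toℕ i))) ∧ (t̂ (suc (toℕ i)) ≤ᵇ Nsum (suc (toℕ i))))
  meetsAt≡ μ i rewrite Npre≡sumTo m ns (toℕ i) | Npre≡sumTo m ns (suc (toℕ i)) | extend-toℕ m ts i | diag≡ (suc (toℕ i)) = refl

  meetsAt⇒passes : ∀ μ i → meetsAt ns ts μ i ≡ true → passes μ (suc (toℕ i))
  meetsAt⇒passes μ i e = ≡ᵇ-true⇒≡ {ycoord μ (diag (suc (toℕ i)))} (proj₁ (∧-true (trans (sym (meetsAt≡ μ i)) e)))

  -- the inequality part of meetsAt follows since a path never rises above the step count
  passes⇒meetsAt : ∀ μ i → passes μ (suc (toℕ i)) → meetsAt ns ts μ i ≡ true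
  passes⇒meetsAt μ i p = trans (meetsAt≡ μ i) (cong₂ _∧_ (≡⇒≡ᵇ-true {ycoord μ (diag (suc b))} p) (≤⇒≤ᵇ-true t≤x))
    where
      b = toℕ i
      t≤x : t̂ (suc b) ≤ Nsum (suc b)
      t≤x = +-cancelʳ-≤ (Nsum (suc (suc b))) _ _ (begin
        t̂ (suc b) + Nsum (suc (suc b))  ≡⟨ +-comm (t̂ (suc b)) _ ⟩
        Nsum (suc (suc b)) + t̂ (suc b)  ≡⟨ sym p ⟩
        ycoord μ (diag (suc b))          ≤⟨ ycoord-≤ μ (diag (suc b)) ⟩
        diag (suc b)                     ≡⟨ diag≡ (suc b) ⟩
        Nsum (suc b) + Nsum (suc (suc b)) ∎)
        where open ≤-Reasoning

  passes⇒aboveStaircase : ∀ μ s i → i ≤ ℓ s → passes μ s → passes μ (suc s) →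
    Nsum (suc s) + (i ∸ n̂ s) ≤ ycoord μ (diag s + i)
  passes⇒aboveStaircase μ s i i≤ p p′ with i ≤? n̂ s
  ... | yes i≤n = begin
    Nsum (suc s) + (i ∸ n̂ s)  ≡⟨ cong (Nsum (suc s) +_) (m≤n⇒m∸n≡0 i≤n) ⟩
    Nsum (suc s) + 0           ≤⟨ +-monoʳ-≤ (Nsum (suc s)) z≤n ⟩
    Nsum (suc s) + t̂ s        ≡⟨ sym p ⟩
    ycoord μ (diag s)          ≤⟨ ycoord-mono μ (diag s) i ⟩
    ycoord μ (diag s + i)      ∎
    where open ≤-Reasoning
  ... | no i≰n = +-cancelʳ-≤ d _ _ (begin
    Nsum (suc s) + i′ + d       ≡⟨ +-assoc (Nsum (suc s)) i′ d ⟩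
    Nsum (suc s) + (i′ + d)     ≡⟨ cong (Nsum (suc s) +_) i′+d ⟩
    Nsum (suc s) + n̂ (suc s)   ≤⟨ m≤m+n _ _ ⟩
    Nsum (suc s) + n̂ (suc s) + t̂ (suc s)  ≡⟨ cong (_+ t̂ (suc s)) (sym (Nsum-last (suc s))) ⟩
    Nsum (suc (suc s)) + t̂ (suc s)         ≡⟨ sym p′ ⟩
    ycoord μ (diag (suc s))     ≡⟨ cong (ycoord μ) nextDiag ⟩
    ycoord μ (diag s + i + d)   ≤⟨ ycoord-lipschitz μ (diag s + i) d ⟩
    ycoord μ (diag s + i) + d   ∎)
    where
      open ≤-Reasoning
      i′ = i ∸ n̂ s
      n+i′ : n̂ s + i′ ≡ i
      n+i′ = m+[n∸m]≡n (<⇒≤ (≰⇒> i≰n))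
      i′≤ : i′ ≤ n̂ (suc s)
      i′≤ = +-cancelˡ-≤ (n̂ s) _ _ (subst (_≤ ℓ s) (sym n+i′) i≤)
      d = n̂ (suc s) ∸ i′
      i′+d : i′ + d ≡ n̂ (suc s)
      i′+d = m+[n∸m]≡n i′≤
      nextDiag : diag (suc s) ≡ diag s + i + d
      nextDiag = trans (diag-last s) (trans (cong (diag s +_)
        (trans (cong (n̂ s +_) (sym i′+d)) (trans (sym (+-assoc (n̂ s) i′ d)) (cong (_+ d) n+i′)))) (sym (+-assoc (diag s) i d)))

  passesAll⇒notBelow : ∀ μ → length μ ≡ diag r → passesAll μ → notBelow lam μ ≡ true
  passesAll⇒notBelow μ len h = upTo⇐ (suc (length lam)) id (λ j → ycoord lam j ≤ᵇ ycoord μ j) below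
    where
      below : ∀ j → j < suc (length lam) → (ycoord lam j ≤ᵇ ycoord μ j) ≡ true
      below j (s≤s p) with segment-cover r ℓ j z<s (subst (j ≤_) length-lam p)
      ... | s , i , s< , i≤ , j≡ = ≤⇒≤ᵇ-true (begin
        ycoord lam j                     ≡⟨ cong₂ ycoord lam≡staircase j≡ ⟩
        ycoord (staircase r n̂) (diag s + i)  ≤⟨ ycoord-staircase r n̂ s i s< i≤ ⟩
        Nsum (suc s) + (i ∸ n̂ s)        ≤⟨ passes⇒aboveStaircase μ s i i≤ (h s (<⇒≤ s<)) (h (suc s) s<) ⟩
        ycoord μ (diag s + i)            ≡⟨ cong (ycoord μ) (sym j≡) ⟩
        ycoord μ j                       ∎)
        where open ≤-Reasoning

  ups≡N : ∀ μ → length μ ≡ diag r → passes μ r → ups μ ≡ N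
  ups≡N μ len p = trans (sym (ycoord-end μ len)) (trans p lastPoint)

  passesAll⇒isPath : ∀ μ → length μ ≡ diag r → passesAll μ → isPath μ ≡ true
  passesAll⇒isPath μ len h = ≡⇒≡ᵇ-true {ups μ} (ups≡N μ len (h r ≤-refl))

  passesAll⇒inL′ : ∀ μ → length μ ≡ diag r → passesAll μ → inL′ μ ≡ true
  passesAll⇒inL′ μ len h = cong₂ _∧_ (passesAll⇒notBelow μ len h)
    (allFinB⇐ (suc m) _ (λ i → passes⇒meetsAt μ i (h (suc (toℕ i)) (m≤n⇒m≤1+n (toℕ<n i)))))

  -- conversely the last point is forced by ending at (N,N), the inner ones by meetsAt
  inL′⇒passesAll : ∀ μ → length μ ≡ diag r → isPath μ ≡ true → inL′ μ ≡ true → passesAll μ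
  inL′⇒passesAll μ len path member zero p = refl
  inL′⇒passesAll μ len path member (suc b) (s≤s p) with b ≤? m
  ... | yes b≤m = subst (λ z → passes μ (suc z)) (toℕ-fromℕ< (s≤s b≤m))
         (meetsAt⇒passes μ (fromℕ< (s≤s b≤m)) (allFinB⇒ (suc m) (meetsAt ns ts μ) (proj₂ (∧-true {notBelow lam μ} member)) (fromℕ< (s≤s b≤m))))
  ... | no b≰m = subst (passes μ) (cong suc (sym (≤-antisym p (≰⇒> b≰m))))
         (trans (ycoord-end μ len) (trans (≡ᵇ-true⇒≡ {ups μ} path) (sym lastPoint)))

  excessₛ : ℕ → ℕ
  excessₛ s = excess (n̂ s) (t̂ s) (n̂ (suc s)) (t̂ (suc s))

  segmentInversions : List Step → ℕ → ℕ
  segmentInversions μ s = inversions (segment ℓ s μ)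

  length-segment : ∀ μ s → length μ ≡ diag r → s < r → length (segment ℓ s μ) ≡ ℓ s
  length-segment μ s len s< = trans (length-take (ℓ s) (drop (diag s) μ))
    (m≤n⇒m⊓n≡m (subst (ℓ s ≤_) (sym (trans (length-drop (diag s) μ) (cong (_∸ diag s) len)))
      (m+n≤o⇒m≤o∸n (ℓ s) (subst (_≤ diag r) (trans (diag-last s) (+-comm (diag s) (ℓ s))) (sumTo-mono ℓ (suc s) r s<)))))

  staircaseSegment : ℕ → ℕ
  staircaseSegment s = ℓ s * Nsum (suc s) + tri (n̂ (suc s))

  heightSum-segment : ∀ μ → length μ ≡ diag r → passesAll μ → ∀ s → s < r →
    heightSum (ycoord μ (diag s)) (segment ℓ s μ) ≡ staircaseSegment s + (excessₛ s + segmentInversions μ s)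
  heightSum-segment μ len h s s< = begin
    heightSum (ycoord μ (diag s)) w              ≡⟨ heightSum-shift _ w ⟩
    ycoord μ (diag s) * length w + heightSum 0 w ≡⟨ cong₂ (λ a b → a * b + heightSum 0 w) (h s (<⇒≤ s<)) (length-segment μ s len s<) ⟩
    (Nsum (suc s) + t̂ s) * ℓ s + heightSum 0 w  ≡⟨ cong ((Nsum (suc s) + t̂ s) * ℓ s +_) (heightSum-inversions w) ⟩
    (Nsum (suc s) + t̂ s) * ℓ s + (inversions w + tri u)
      ≡⟨ solve 5 (λ a t l x T → (a :+ t) :* l :+ (x :+ T) := l :* a :+ (l :* t :+ T) :+ x) refl (Nsum (suc s)) (t̂ s) (ℓ s) (inversions w) (tri u) ⟩
    ℓ s * Nsum (suc s) + (ℓ s * t̂ s + tri u) + inversions w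
      ≡⟨ cong (λ z → ℓ s * Nsum (suc s) + z + inversions w) (segment-excess (n̂ s) (t̂ s) (n̂ (suc s)) (t̂ (suc s)) u exits) ⟩
    ℓ s * Nsum (suc s) + (tri (n̂ (suc s)) + excessₛ s) + inversions w
      ≡⟨ solve 4 (λ a b c d → a :+ (b :+ c) :+ d := a :+ b :+ (c :+ d)) refl (ℓ s * Nsum (suc s)) (tri (n̂ (suc s))) (excessₛ s) (inversions w) ⟩
    staircaseSegment s + (excessₛ s + segmentInversions μ s) ∎
    where
      open ≡-Reasoning
      w = segment ℓ s μ
      u = ups w
      exits : u + t̂ s ≡ n̂ (suc s) + t̂ (suc s)
      exits = ≡ᵇ-true⇒≡ {u + t̂ s} (passesAll⇒fits μ h s s<)

  heightSum-decomposition : ∀ μ → length μ ≡ diag r → passesAll μ →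
    heightSum 0 μ ≡ heightSum 0 lam + (sumTo r excessₛ + sumTo r (segmentInversions μ))
  heightSum-decomposition μ len h = begin
    heightSum 0 μ  ≡⟨ heightSum-segments r ℓ 0 μ len ⟩
    sumTo r (λ s → heightSum (ycoord μ (diag s)) (segment ℓ s μ))  ≡⟨ sumTo-cong r _ _ (heightSum-segment μ len h) ⟩
    sumTo r (λ s → staircaseSegment s + (excessₛ s + segmentInversions μ s))  ≡⟨ sumTo-+ r staircaseSegment (λ s → excessₛ s + segmentInversions μ s) ⟩
    sumTo r staircaseSegment + sumTo r (λ s → excessₛ s + segmentInversions μ s)
      ≡⟨ cong₂ _+_ (sym (trans (cong (heightSum 0) lam≡staircase) (heightSum-staircase r n̂ 0))) (sumTo-+ r excessₛ (segmentInversions μ)) ⟩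
    heightSum 0 lam + (sumTo r excessₛ + sumTo r (segmentInversions μ)) ∎
    where open ≡-Reasoning

  -- μ and λ have the same number of up steps, so their areas differ as their heightSums do
  skewArea-decomposition : ∀ μ → length μ ≡ diag r → passesAll μ →
    skewArea lam μ ≡ sumTo r excessₛ + sumTo r (segmentInversions μ)
  skewArea-decomposition μ len h = trans (cong (_∸ area lam) areaμ) (m+n∸m≡n (area lam) Y)
    where
      Y = sumTo r excessₛ + sumTo r (segmentInversions μ)
      c = triFrom 0 N
      areaμ : area μ ≡ area lam + Y
      areaμ = +-cancelʳ-≡ c _ _ (begin
        area μ + c         ≡⟨ cong (λ z → area μ + triFrom 0 z) (sym (ups≡N μ len (h r ≤-refl))) ⟩
        area μ + triFrom 0 (ups μ)  ≡⟨ sym (heightSum-area 0 μ) ⟩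
        heightSum 0 μ      ≡⟨ heightSum-decomposition μ len h ⟩
        heightSum 0 lam + Y  ≡⟨ cong (_+ Y) (trans (heightSum-area 0 lam) (cong (λ z → area lam + triFrom 0 z) ups-lam)) ⟩
        area lam + c + Y   ≡⟨ solve 3 (λ a c y → a :+ c :+ y := a :+ y :+ c) refl (area lam) c Y ⟩
        area lam + Y + c   ∎)
        where open ≡-Reasoning

  weight : ℕ → List Step → ℕ
  weight q μ = if isPath μ then (if inL′ μ then q ^ skewArea lam μ else 0) else 0

  genL′≡wordSum : ∀ q → genL′ q (suc m) ns ts ≡ wordSum (diag r) (weight q)
  genL′≡wordSum q = begin
    genL′ q (suc m) ns ts
      ≡⟨ sum-filter inL′ (λ μ → q ^ skewArea lam μ) (latticePaths N) ⟩
    sum (map (λ μ → if inL′ μ then q ^ skewArea lam μ else 0) (latticePaths N))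
      ≡⟨ sum-filter isPath (λ μ → if inL′ μ then q ^ skewArea lam μ else 0) (words (N + N)) ⟩
    sum (map (weight q) (words (N + N)))  ≡⟨ sum-words (N + N) (weight q) ⟩
    wordSum (N + N) (weight q)             ≡⟨ cong (λ L → wordSum L (weight q)) N+N≡diag ⟩
    wordSum (diag r) (weight q)            ∎
    where open ≡-Reasoning

  segmentWeights : ℕ → List Step → ℕ
  segmentWeights q μ = prodTo r (λ s → shiftedWeight q (t̂ s) (n̂ (suc s) + t̂ (suc s)) (segment ℓ s μ))

  -- The weight of a word factorises as q^{total excess} times its segment weights: both sides
  -- vanish unless μ passes through all prescribed points, and then the area decomposes.
  weight-factorises : ∀ q μ → length μ ≡ diag r → weight q μ ≡ q ^ sumTo r excessₛ * segmentWeights q μ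
  weight-factorises q μ len rewrite prodTo-if q r (segmentFits μ) (segmentInversions μ) with allBelow r (segmentFits μ) in fits
  ... | true = passingWeight (fits⇒passesAll μ (allBelow⇒ r (segmentFits μ) fits))
    where
      passingWeight : passesAll μ → weight q μ ≡ q ^ sumTo r excessₛ * q ^ sumTo r (segmentInversions μ)
      passingWeight h rewrite passesAll⇒isPath μ len h | passesAll⇒inL′ μ len h | skewArea-decomposition μ len h =
        ^-distribˡ-+-* q (sumTo r excessₛ) (sumTo r (segmentInversions μ))
  ... | false with isPath μ in path | inL′ μ in member
  ...   | false | _     = sym (*-zeroʳ (q ^ sumTo r excessₛ))
  ...   | true  | false = sym (*-zeroʳ (q ^ sumTo r excessₛ))
  ...   | true  | true  = ⊥-elim (true≢false (trans
          (sym (allBelow⇐ r (segmentFits μ) (passesAll⇒fits μ (inL′⇒passesAll μ len path member)))) fits))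

  segmentBinomial : ℕ → ℕ → ℕ
  segmentBinomial q s = qbinomℤ q (n̂ s + n̂ (suc s)) (n̂ s + t̂ s) (t̂ (suc s))

  wordSum-segmentWeights : ∀ q → wordSum (diag r) (segmentWeights q) ≡ prodTo r (segmentBinomial q)
  wordSum-segmentWeights q =
    trans (wordSum-segments r ℓ (λ s → shiftedWeight q (t̂ s) (n̂ (suc s) + t̂ (suc s))))
          (prodTo-cong r _ _ (λ s → wordSum-shiftedWeight q (n̂ s) (t̂ s) (n̂ (suc s)) (t̂ (suc s))))

  -- Under t_1 = t_k = 0 the padded segments 0 and k are trivial, which identifies the total
  -- excess with the exponent of the theorem and the segment binomials with its product.
  module Boundary (t₁≡0 : ts fzero ≡ 0) (tₖ≡0 : ts (fromℕ m) ≡ 0) where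

    t̂-first : t̂ 1 ≡ 0
    t̂-first = t₁≡0

    t̂-penultimate : t̂ (suc m) ≡ 0
    t̂-penultimate = trans (sym (trans (extend-toℕ m ts (fromℕ m)) (cong (extend m ts) (toℕ-fromℕ m)))) tₖ≡0

    inject₁≡ : ∀ (f : Fin (suc m) → ℕ) (i : Fin m) → f (inject₁ i) ≡ extend m f (toℕ i)
    inject₁≡ f i = trans (extend-toℕ m f (inject₁ i)) (cong (extend m f) (toℕ-inject₁ i))

    fsuc≡ : ∀ (f : Fin (suc m) → ℕ) (i : Fin m) → f (fsuc i) ≡ extend m f (suc (toℕ i))
    fsuc≡ f i = extend-toℕ m f (fsuc i)

    inner : ∀ g → g 0 ≡ 0 → g (suc m) ≡ 0 → sumTo r g ≡ sumTo m (g ∘ suc)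
    inner g g₀ gₘ = trans (sumTo-ends m g) (trans (cong₂ (λ a b → a + sumTo m (g ∘ suc) + b) g₀ gₘ) (+-identityʳ _))

    linear quadratic : ℕ → ℕ
    linear s = n̂ s * t̂ s + n̂ (suc s) * t̂ (suc s)
    quadratic s = ∣ t̂ s - t̂ (suc s) ∣ * ∣ t̂ s - t̂ (suc s) ∣

    sum-linear : sumTo r linear ≡ linExp m ns ts
    sum-linear = trans (inner linear (trans (cong (n̂ 1 *_) t̂-first) (*-zeroʳ (n̂ 1)))
                                     (trans (cong₂ (λ a b → n̂ (suc m) * a + b * t̂ r) t̂-penultimate n̂-last) (cong (_+ 0) (*-zeroʳ (n̂ (suc m))))))
      (sym (sum-allFin m _ (linear ∘ suc) (λ i → cong₂ _+_ (cong₂ _*_ (inject₁≡ ns i) (inject₁≡ ts i)) (cong₂ _*_ (fsuc≡ ns i) (fsuc≡ ts i)))))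

    sum-quadratic : sumTo r quadratic ≡ sqSum m ts
    sum-quadratic = trans (inner quadratic (cong (λ a → ∣ 0 - a ∣ * ∣ 0 - a ∣) t̂-first)
                                           (cong₂ (λ a b → ∣ a - b ∣ * ∣ a - b ∣) t̂-penultimate t̂-last))
      (sym (sum-allFin m _ (quadratic ∘ suc) (λ i → cong₂ (λ a b → ∣ a - b ∣ * ∣ a - b ∣) (inject₁≡ ts i) (fsuc≡ ts i))))

    -- the offsets telescope: Σ_s t_s = Σ_s t_{s+1} since t_0 = t_{k+1} = 0
    offsets-telescope : sumTo r t̂ ≡ sumTo r (t̂ ∘ suc)
    offsets-telescope = sym (trans (sumTo-last (suc m) (t̂ ∘ suc)) (trans (cong (sumTo (suc m) (t̂ ∘ suc) +_) t̂-last) (+-identityʳ _)))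

    twice-totalExcess : 2 * sumTo r excessₛ ≡ 2 * linExp m ns ts + sqSum m ts
    twice-totalExcess = +-cancelʳ-≡ (sumTo r t̂) _ _ (begin
      2 * sumTo r excessₛ + sumTo r t̂              ≡⟨ cong (_+ sumTo r t̂) (sym (sumTo-*ˡ r 2 excessₛ)) ⟩
      sumTo r (λ s → 2 * excessₛ s) + sumTo r t̂   ≡⟨ sym (sumTo-+ r (λ s → 2 * excessₛ s) t̂) ⟩
      sumTo r (λ s → 2 * excessₛ s + t̂ s)         ≡⟨ sumTo-cong r _ _ (λ s _ → twice s) ⟩
      sumTo r (λ s → 2 * linear s + quadratic s + t̂ (suc s))  ≡⟨ sumTo-+ r (λ s → 2 * linear s + quadratic s) (t̂ ∘ suc) ⟩
      sumTo r (λ s → 2 * linear s + quadratic s) + sumTo r (t̂ ∘ suc)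
        ≡⟨ cong (_+ sumTo r (t̂ ∘ suc)) (sumTo-+ r (λ s → 2 * linear s) quadratic) ⟩
      sumTo r (λ s → 2 * linear s) + sumTo r quadratic + sumTo r (t̂ ∘ suc)
        ≡⟨ cong₂ (λ a b → a + b + sumTo r (t̂ ∘ suc)) (trans (sumTo-*ˡ r 2 linear) (cong (2 *_) sum-linear)) sum-quadratic ⟩
      2 * linExp m ns ts + sqSum m ts + sumTo r (t̂ ∘ suc)  ≡⟨ cong (2 * linExp m ns ts + sqSum m ts +_) (sym offsets-telescope) ⟩
      2 * linExp m ns ts + sqSum m ts + sumTo r t̂  ∎)
      where
        open ≡-Reasoning
        twice : ∀ s → 2 * excessₛ s + t̂ s ≡ 2 * linear s + quadratic s + t̂ (suc s)
        twice s = trans (twice-excess (n̂ s) (t̂ s) (n̂ (suc s)) (t̂ (suc s)))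
                        (cong (λ z → z + quadratic s + t̂ (suc s)) (sym (*-distribˡ-+ 2 (n̂ s * t̂ s) _)))

    -- in particular the sum of squares is even and the division in rhsExp is exact
    totalExcess≡rhsExp : sumTo r excessₛ ≡ rhsExp m ns ts
    totalExcess≡rhsExp = trans (sym (m+[n∸m]≡n lin≤)) (cong (lin +_) (sym half))
      where
        lin = linExp m ns ts
        sq = sqSum m ts
        X = sumTo r excessₛ
        lin≤ : lin ≤ X
        lin≤ = *-cancelˡ-≤ 2 (subst (2 * lin ≤_) (sym twice-totalExcess) (m≤m+n _ _))
        D = X ∸ lin
        sq≡ : sq ≡ D * 2
        sq≡ = +-cancelˡ-≡ (2 * lin) _ _ (begin
          2 * lin + sq      ≡⟨ sym twice-totalExcess ⟩
          2 * X             ≡⟨ cong (2 *_) (sym (m+[n∸m]≡n lin≤)) ⟩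
          2 * (lin + D)     ≡⟨ solve 2 (λ l d → con 2 :* (l :+ d) := con 2 :* l :+ d :* con 2) refl lin D ⟩
          2 * lin + D * 2   ∎)
          where open ≡-Reasoning
        half : sq / 2 ≡ D
        half = trans (cong (_/ 2) sq≡) (m*n/n≡m D 2)

    segmentBinomials≡binomProd : ∀ q → prodTo r (segmentBinomial q) ≡ binomProd q m ns ts
    segmentBinomials≡binomProd q = begin
      B 0 * prodTo (suc m) (B ∘ suc)              ≡⟨ cong₂ _*_ first (prodTo-last m (B ∘ suc)) ⟩
      1 * (prodTo m (B ∘ suc) * B (suc m))        ≡⟨ cong (λ z → 1 * (prodTo m (B ∘ suc) * z)) last ⟩
      1 * (prodTo m (B ∘ suc) * 1)                ≡⟨ trans (*-identityˡ _) (*-identityʳ _) ⟩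
      prodTo m (B ∘ suc)                          ≡⟨ sym (product-allFin m _ (B ∘ suc) innerFactor) ⟩
      binomProd q m ns ts ∎
      where
        open ≡-Reasoning
        B = segmentBinomial q
        -- segment 0 is [n_1 choose 0]_q and segment k is [n_k choose n_k]_q
        first : B 0 ≡ 1
        first rewrite t̂-first = begin
          qbinom q (n̂ 1) 0          ≡⟨ cong (λ z → qbinom q z 0) (sym (+-identityʳ (n̂ 1))) ⟩
          qbinom q (n̂ 1 + 0) 0      ≡⟨ qbinom≡gauss q (n̂ 1) 0 ⟩
          gauss q (n̂ 1 + 0) (n̂ 1)  ≡⟨ cong (λ z → gauss q z (n̂ 1)) (+-identityʳ (n̂ 1)) ⟩
          gauss q (n̂ 1) (n̂ 1)      ≡⟨ gauss-diag q (n̂ 1) ⟩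
          1                          ∎
        last : B (suc m) ≡ 1
        last rewrite n̂-last | t̂-penultimate | t̂-last = trans (qbinom≡gauss q 0 (n̂ (suc m) + 0)) (gauss-zero q (n̂ (suc m) + 0))
        innerFactor : ∀ i → _ ≡ B (suc (toℕ i))
        innerFactor i = cong₂ (λ a b → qbinomℤ q (proj₁ a + proj₂ a) (proj₁ a + proj₁ b) (proj₂ b))
                              (cong₂ _,_ (inject₁≡ ns i) (fsuc≡ ns i)) (cong₂ _,_ (inject₁≡ ts i) (fsuc≡ ts i))

lemma4p1 : (m : ℕ) (ns ts : Fin (suc m) → ℕ) →
    ts fzero ≡ 0 → ts (fromℕ m) ≡ 0 →
    (q : ℕ) →
    genL′ q (suc m) ns ts ≡ q ^ rhsExp m ns ts * binomProd q m ns ts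
lemma4p1 m ns ts t₁≡0 tₖ≡0 q = begin
  genL′ q (suc m) ns ts                               ≡⟨ genL′≡wordSum q ⟩
  wordSum (diag r) (weight q)                         ≡⟨ wordSum-cong (diag r) _ _ (weight-factorises q) ⟩
  wordSum (diag r) (λ μ → q ^ E * segmentWeights q μ) ≡⟨ wordSum-*ˡ (diag r) (q ^ E) (segmentWeights q) ⟩
  q ^ E * wordSum (diag r) (segmentWeights q)         ≡⟨ cong (q ^ E *_) (wordSum-segmentWeights q) ⟩
  q ^ E * prodTo r (segmentBinomial q)
    ≡⟨ cong₂ (λ e b → q ^ e * b) totalExcess≡rhsExp (segmentBinomials≡binomProd q) ⟩
  q ^ rhsExp m ns ts * binomProd q m ns ts ∎
  where
    open ≡-Reasoning
    open Blocks m ns ts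
    open Boundary t₁≡0 tₖ≡0
    E = sumTo r excessₛ
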